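{- Let $G$ be a signed graph (bidirected graph) with vertex set $V$, let $u_1,u_2\in V$ be distinct (source $u_1$, sink $u_2$) and let $w_1,w_2\in V$ be distinct. Then there is a bijection between the set of Tutte-$2$-arborescences for $[u_1u_2,w_1w_2]$ and the set $\widehat{\mathfrak{C}}^1_{\neq0}(L^0(G);u_1u_2,w_1w_2)$.
   Context: An oriented hypergraph $G$ consists of finite sets $V$ (vertices), $E$ (edges), $I$ (incidences), maps $\varsigma:I\to V$, $\omega:I\to E$, and an orientation $\sigma:I\to\{+1,-1\}$. An adjacency is an ordered pair $(i,j)$ of distinct incidences with $\omega(i)=\omega(j)$; it goes from $\varsigma(i)$ to $\varsigma(j)$, its tail incidence is $i$, and its sign is $-\sigma(i)\sigma(j)$. A backstep at $v$ is the degenerate step $v,i,\omega(i),i,v$ with $\varsigma(i)=v$; its tail incidence is $i$. A bidirected graph is an oriented hypergraph in which every edge has exactly two incidences; labelling each edge by the sign of its adjacency gives a signed graph. A Tutte-$2$-arborescence for $[u_1u_2,w_1w_2]$ is a spanning forest $F$ of (the underlying graph of) $G$ with exactly two components, one containing $u_1$ and the other containing $u_2$, such that either $u_1,w_1$ lie in one component and $u_2,w_2$ in the other, or $u_1,w_2$ lie in one component and $u_2,w_1$ in the other. Reduced contributors: for sequences $\mathbf u=(u_1,\dots,u_k)$, $\mathbf w=(w_1,\dots,w_k)$ of vertices with $U=\{u_1,\dots,u_k\}$, $\widehat{\mathfrak{C}}_{\neq0}(L^0(G);\mathbf u,\mathbf w)$ is the set of assignments $c$ choosing, for each $v\in V\setminus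 U$, either an adjacency of $G$ starting at $v$ or a backstep at $v$, such that the map $\pi_c:V\to V$ defined by $\pi_c(v)=$ endpoint (head) of the chosen step for $v\notin U$ and $\pi_c(u_i)=w_i$ is a well-defined bijection (these are the contributors of the zero-loading $L^0(G)$ with $u_i\mapsto w_i$, with those $k$ maps removed, whose remaining steps lie in $G$). The unreduced contributor $\check c$ is $c$ together with the formal arcs $u_i\to w_i$. A circle of $c$ is a cycle of $\pi_c$ of length at least $2$ all of whose arcs are adjacencies of $c$ (no formal arcs). Two elements of $\widehat{\mathfrak{C}}_{\neq0}(L^0(G);\mathbf u,\mathbf w)$ are tail-equivalent if for every $v\in V\setminus U$ their steps at $v$ have the same tail incidence; the equivalence classes are the reduced activation classes, partially ordered by inclusion of circle sets. $\widehat{\mathfrak{C}}^1_{\neq0}(L^0(G);\mathbf u,\mathbf w)$ denotes the union of the single-element reduced activation classes. For $k=2$ we write $u_1u_2,w_1w_2$ for $\mathbf u=(u_1,u_2)$, $\mathbf w=(w_1,w_2)$. -}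

module Defs where

open import Level using (0ℓ)
open import Data.Nat using (ℕ; suc)
open import Data.Fin using (Fin; zero; suc; inject₁; fromℕ; _≟_)
open import Data.Fin.Subset using (Subset; _∈_)
open import Data.Sign using (Sign)
open import Data.Product using (Σ; _×_; _,_; proj₁; proj₂)
open import Data.Sum using (_⊎_)
open import Data.Empty using (⊥)
open import Relation.Nullary using (¬_; yes; no)
open import Relation.Binary.PropositionalEquality
  using (_≡_; _≢_; refl; sym; trans)
open import Relation.Binary.Bundles using (Setoid)
open import Function.Definitions using (Injective; Bijective)

-- Vertices V = Fin n, edges E = Fin m, incidences
-- I = E × Fin 2; ω (e , k) = e, ς (e , k) = end e k, σ (e , k) = sgn e k.

record BidirectedGraph : Set where
  field
    n   : ℕ
    m   : ℕ
    end : Fin m → Fin 2 → Fin n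
    sgn : Fin m → Fin 2 → Sign

other : Fin 2 → Fin 2
other zero       = suc zero
other (suc zero) = zero

module _ (G : BidirectedGraph) where
  open BidirectedGraph G

  Vertex : Set
  Vertex = Fin n

  Incidence : Set
  Incidence = Fin m × Fin 2

  -- Steps: adjacencies starting at v, or backsteps at v.
  -- An adjacency (i , j) with i = (e , k) necessarily has j = (e , other k),
  -- so it is determined by its tail incidence.

  data Kind : Set where
    adjacency backstep : Kind

  record Step (v : Vertex) : Set where
    constructor step
    field
      kind : Kind
      edge : Fin m
      side : Fin 2
      at   : end edge side ≡ v

  headOf : ∀ {v} → Step v → Vertex
  headOf {v} (step adjacency e k _) = end e (other k)
  headOf {v} (step backstep  e k _) = v

  tailOf : ∀ {v} → Step v → Incidence
  tailOf s = Step.edge s , Step.side s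

  StepEq : ∀ {v} → Step v → Step v → Set
  StepEq s t = (Step.kind s ≡ Step.kind t) × (Step.edge s ≡ Step.edge t)
             × (Step.side s ≡ Step.side t)

  module _ (u₁ u₂ w₁ w₂ : Vertex) where

    Assignment : Set
    Assignment = (v : Vertex) → .(v ≢ u₁) → .(v ≢ u₂) → Step v

    π : Assignment → Vertex → Vertex
    π c v with v ≟ u₁ | v ≟ u₂
    ... | yes _ | _     = w₁
    ... | no _  | yes _ = w₂
    ... | no p  | no q  = headOf (c v p q)

    IsContributor : Assignment → Set
    IsContributor c = Bijective _≡_ _≡_ (π c)

    AssignEq : Assignment → Assignment → Set
    AssignEq c d = ∀ v (p : v ≢ u₁) (q : v ≢ u₂) → StepEq (c v p q) (d v p q)

    TailEquivalent : Assignment → Assignment → Set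
    TailEquivalent c d =
      ∀ v (p : v ≢ u₁) (q : v ≢ u₂) → tailOf (c v p q) ≡ tailOf (d v p q)

    -- c lies in a single-element reduced activation class
    SingleClass : Assignment → Set
    SingleClass c = ∀ d → IsContributor d → TailEquivalent c d → AssignEq c d

    Ĉ¹ : Set
    Ĉ¹ = Σ Assignment (λ c → IsContributor c × SingleClass c)

    Ĉ¹-setoid : Setoid 0ℓ 0ℓ
    Ĉ¹-setoid = record
      { Carrier = Ĉ¹
      ; _≈_ = λ x y → AssignEq (proj₁ x) (proj₁ y)
      ; isEquivalence = record
        { refl  = λ v p q → refl , refl , refl
        ; sym   = λ e v p q → let (a , b , c) = e v p q in sym a , sym b , sym c
        ; trans = λ e f v p q → let (a , b , c) = e v p q ; (a' , b' , c') = f v p q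
                                in trans a a' , trans b b' , trans c c'
        }
      }

  data Connected (F : Subset m) : Vertex → Vertex → Set where
    here  : ∀ {v} → Connected F v v
    there : ∀ {e k y} → e ∈ F → Connected F (end e (other k)) y
          → Connected F (end e k) y

  record Cycle (F : Subset m) : Set where
    field
      len      : ℕ
      edgeAt   : Fin (suc len) → Fin m
      sideAt   : Fin (suc len) → Fin 2
      inF      : ∀ i → edgeAt i ∈ F
      edgeInj  : Injective _≡_ _≡_ edgeAt
      vtxInj   : Injective _≡_ _≡_ (λ i → end (edgeAt i) (sideAt i))
      consec   : ∀ (i : Fin len) →
                 end (edgeAt (inject₁ i)) (other (sideAt (inject₁ i)))
                   ≡ end (edgeAt (suc i)) (sideAt (suc i))
      closed   : end (edgeAt (fromℕ len)) (other (sideAt (fromℕ len)))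
                   ≡ end (edgeAt zero) (sideAt zero)

  IsForest : Subset m → Set
  IsForest F = ¬ Cycle F

  IsTutte2Arborescence : Vertex → Vertex → Vertex → Vertex → Subset m → Set
  IsTutte2Arborescence u₁ u₂ w₁ w₂ F =
    IsForest F
    × (∀ v → Connected F u₁ v ⊎ Connected F u₂ v)
    × ¬ Connected F u₁ u₂
    × ((Connected F u₁ w₁ × Connected F u₂ w₂)
       ⊎ (Connected F u₁ w₂ × Connected F u₂ w₁))

  Tutte2Arb-setoid : Vertex → Vertex → Vertex → Vertex → Setoid 0ℓ 0ℓ
  Tutte2Arb-setoid u₁ u₂ w₁ w₂ = record
    { Carrier = Σ (Subset m) (IsTutte2Arborescence u₁ u₂ w₁ w₂)
    ; _≈_ = λ x y → proj₁ x ≡ proj₁ y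
    ; isEquivalence = record { refl = refl ; sym = sym ; trans = trans }
    }

module Submission where

-- Every vertex outside U = {u₁, u₂} has a tail: the incidence its step leaves by. The other ends
-- of the tails define a parent map on V fixing U, and the tail edges form a graph in which each
-- vertex is joined to its parent. For a contributor the kinds are forced by the tails: a vertex
-- takes an adjacency exactly when it lies on the parent path from w₁ or w₂ to U, since π moves
-- u_j to w_j and then one step up that path. So a reduced activation class is a singleton exactly
-- when the parent map reaches U from every vertex: on a parent cycle avoiding U all steps have the
-- same kind and toggling them all gives a second contributor with the same tails. For such rooted
-- tails the tail edges form a Tutte-2-arborescence (a vertex of maximal height on a cycle would
-- own two of its edges), and conversely the distance-decreasing edges of a Tutte-2-arborescence
-- are the tails of a unique single-class contributor; no other edge can be present, as it would
-- close a cycle through the first common vertex of the parent paths of its ends.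

open import Defs
open import Relation.Binary.PropositionalEquality using (_≢_)
open import Function.Bundles using (Bijection)
open import Level using (0ℓ)
open import Data.Nat as ℕ using (ℕ; zero; suc; _+_; _*_; _∸_; _≤_; _<_; z≤n; s≤s; _≤?_; _<?_)
open import Data.Nat.DivMod using (_%_; _/_; m≡m%n+[m/n]*n; m%n<n)
open import Data.Nat.Solver using (module +-*-Solver)
open +-*-Solver using (solve; _:+_; _:*_; _:=_; con)
import Data.Nat.Properties as ℕP
open import Data.Fin as Fin using (Fin; zero; suc; toℕ; fromℕ; inject₁; punchOut; _≟_)
import Data.Fin.Properties as FinP
open import Data.Fin.Relation.Unary.Top using (view; ‵fromℕ; ‵inject₁)
open import Data.Fin.Subset using (Subset; _∈_; _⊆_)
open import Data.Fin.Subset.Properties using (_∈?_; ⊆-antisym)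
open import Data.Vec using (tabulate)
open import Data.Vec.Properties using ([]=⇒lookup; lookup⇒[]=; lookup∘tabulate)
open import Data.List using (allFin)
import Data.List.Relation.Unary.All as All
open import Data.List.Membership.Propositional.Properties using (∈-allFin)
import Data.List.Extrema ℕP.≤-totalOrder as Extrema
open import Data.Product using (Σ; Σ-syntax; ∃; ∃-syntax; _×_; _,_; proj₁; proj₂)
open import Data.Sum using (_⊎_; inj₁; inj₂; [_,_]′)
open import Data.Empty using (⊥; ⊥-elim)
import Data.Empty.Irrelevant as Irrelevant
open import Function.Base using (_∘_; id; case_of_)
open import Function.Definitions using (Injective; Bijective)
open import Relation.Nullary using (¬_; yes; no; Dec)
open import Relation.Nullary.Decidable as Dec using (_⊎-dec_; _×-dec_; dec-true)
open import Relation.Nullary.Decidable.Core using (does)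
open import Relation.Unary using (Pred; Decidable)
open import Relation.Binary.PropositionalEquality
open ≡-Reasoning

module _ {P : ℕ → Set} (P? : Decidable P) where

  MinimalWitness : Set
  MinimalWitness = Σ[ i ∈ ℕ ] P i × (∀ j → P j → i ≤ j)

  private
    search : ∀ i → (∀ j → j < i → ¬ P j) → ∀ fuel → P (fuel + i) → MinimalWitness
    search i below fuel p with P? i
    ... | yes pi = i , pi , λ j pj → ℕP.≮⇒≥ (λ j<i → below j j<i pj)
    search i below zero    p | no ¬pi = ⊥-elim (¬pi p)
    search i below (suc f) p | no ¬pi = search (suc i) below′ f (subst P (sym (ℕP.+-suc f i)) p)
      where
      below′ : ∀ j → j < suc i → ¬ P j
      below′ j j<1+i with ℕP.m<1+n⇒m<n∨m≡n j<1+i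
      ... | inj₁ j<i  = below j j<i
      ... | inj₂ refl = ¬pi

  -- Abstract, like the other heavy definitions below: with-abstraction normalises the
  -- types in scope, and unfolding this search (and the proofs it is applied to) explodes.
  abstract
    minimalWitness : ∀ k → P k → MinimalWitness
    minimalWitness k pk = search 0 (λ _ ()) k (subst P (sym (ℕP.+-identityʳ k)) pk)

injective⇒surjective : ∀ {k} {g : Fin k → Fin k} → Injective _≡_ _≡_ g → ∀ y → ∃[ x ] g x ≡ y
injective⇒surjective {zero}  _ ()
injective⇒surjective {suc k} {g} g-inj y with FinP.any? (λ x → g x Fin.≟ y)
... | yes hit = hit
... | no miss = ⊥-elim (ℕP.1+n≰n (FinP.injective⇒≤ h-inj))
  where
  h : Fin (suc k) → Fin k
  h x = punchOut {i = y} {j = g x} (λ y≡gx → miss (x , sym y≡gx))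
  h-inj : Injective _≡_ _≡_ h
  h-inj {a} {b} eq = g-inj (FinP.punchOut-injective (λ e → miss (a , sym e)) (λ e → miss (b , sym e)) eq)

surjective⇒bijective : ∀ {k} {g : Fin k → Fin k} → (∀ y → ∃[ x ] g x ≡ y) → Bijective _≡_ _≡_ g
surjective⇒bijective {k} {g} g-surj = g-inj , λ y → section y , λ { refl → g∘section y }
  where
  section : Fin k → Fin k
  section y = proj₁ (g-surj y)
  g∘section : ∀ y → g (section y) ≡ y
  g∘section y = proj₂ (g-surj y)
  section-surj : ∀ x → ∃[ y ] section y ≡ x
  section-surj = injective⇒surjective
    (λ {y} {y′} eq → trans (sym (g∘section y)) (trans (cong g eq) (g∘section y′)))
  g-inj : Injective _≡_ _≡_ g
  g-inj {x} {x′} eq with section-surj x | section-surj x′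
  ... | y , refl | y′ , refl = cong section (trans (sym (g∘section y)) (trans eq (g∘section y′)))

module _ {m} {P : Pred (Fin m) 0ℓ} (P? : Decidable P) where

  subset : Subset m
  subset = tabulate (λ e → does (P? e))

  ∈-subset⁺ : ∀ {e} → P e → e ∈ subset
  ∈-subset⁺ {e} pe = lookup⇒[]= e subset (trans (lookup∘tabulate _ e) (dec-true (P? e) pe))

  ∈-subset⁻ : ∀ {e} → e ∈ subset → P e
  ∈-subset⁻ {e} e∈ with P? e | trans (sym (lookup∘tabulate (λ e → does (P? e)) e)) ([]=⇒lookup e∈)
  ... | yes pe | _ = pe
  ... | no _   | ()

argmax : ∀ {k} (g : Fin (suc k) → ℕ) → Σ[ t ∈ Fin (suc k) ] (∀ t′ → g t′ ≤ g t)
argmax {k} g = t , λ t′ → All.lookup (Extrema.f[xs]≤f[argmax] {f = g} zero (allFin _)) (∈-allFin t′)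
  where
  t : Fin (suc k)
  t = Extrema.argmax g zero (allFin _)

module Iteration {A : Set} (f : A → A) where
  open import Function.Endo.Propositional A using (_^_; ^-homo)

  ^-+ : ∀ i j x → (f ^ (i + j)) x ≡ (f ^ i) ((f ^ j) x)
  ^-+ i j x = cong-app (^-homo f i j) x

  ^-suc-inner : ∀ k x → (f ^ suc k) x ≡ (f ^ k) (f x)
  ^-suc-inner k x = trans (cong (λ i → (f ^ i) x) (ℕP.+-comm 1 k)) (^-+ k 1 x)

  ^-period-multiple : ∀ {L z} → (f ^ L) z ≡ z → ∀ k → (f ^ (k * L)) z ≡ z
  ^-period-multiple per zero = refl
  ^-period-multiple {L} {z} per (suc k) = begin
    (f ^ (L + k * L)) z   ≡⟨ ^-+ L (k * L) z ⟩
    (f ^ L) ((f ^ (k * L)) z) ≡⟨ cong (f ^ L) (^-period-multiple per k) ⟩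
    (f ^ L) z             ≡⟨ per ⟩
    z                     ∎

  module Absorbing {P : A → Set} (fixes : ∀ {x} → P x → f x ≡ x) where

    ^-fixes : ∀ {x} → P x → ∀ k → (f ^ k) x ≡ x
    ^-fixes px zero    = refl
    ^-fixes px (suc k) = trans (cong f (^-fixes px k)) (fixes px)

    stays : ∀ {i j} x → P ((f ^ i) x) → i ≤ j → (f ^ j) x ≡ (f ^ i) x
    stays {i} x p i≤j with ℕP.m≤n⇒∃[o]m+o≡n i≤j
    ... | d , refl = begin
      (f ^ (i + d)) x       ≡⟨ cong (λ k → (f ^ k) x) (ℕP.+-comm i d) ⟩
      (f ^ (d + i)) x       ≡⟨ ^-+ d i x ⟩
      (f ^ d) ((f ^ i) x)   ≡⟨ ^-fixes p d ⟩
      (f ^ i) x             ∎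

    stays-in : ∀ {i j} x → P ((f ^ i) x) → i ≤ j → P ((f ^ j) x)
    stays-in x p i≤j = subst P (sym (stays x p i≤j)) p

    landing-unique : ∀ i j x → P ((f ^ i) x) → P ((f ^ j) x) → (f ^ i) x ≡ (f ^ j) x
    landing-unique i j x pi pj with ℕP.≤-total i j
    ... | inj₁ i≤j = sym (stays x pi i≤j)
    ... | inj₂ j≤i = stays x pj j≤i

    periodic-avoids : ∀ {L z} → ¬ P z → (f ^ suc L) z ≡ z → ∀ t → ¬ P ((f ^ t) z)
    periodic-avoids {L} {z} ¬pz per t p =
      ¬pz (subst P (^-period-multiple per t) (stays-in z p (ℕP.m≤m*n t (suc L))))

    module Height (P? : Decidable P) (reaches : ∀ x → ∃[ k ] P ((f ^ k) x)) where

      private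
        minimal : ∀ x → MinimalWitness (λ k → P? ((f ^ k) x))
        minimal x = minimalWitness (λ k → P? ((f ^ k) x)) (proj₁ (reaches x)) (proj₂ (reaches x))

      abstract
        height : A → ℕ
        height x = proj₁ (minimal x)

        height-reaches : ∀ x → P ((f ^ height x) x)
        height-reaches x = proj₁ (proj₂ (minimal x))

        height-minimal : ∀ x j → P ((f ^ j) x) → height x ≤ j
        height-minimal x = proj₂ (proj₂ (minimal x))

      height-absorbed : ∀ {x} → P x → height x ≡ 0
      height-absorbed {x} px = ℕP.n≤0⇒n≡0 (height-minimal x 0 px)

      height-step : ∀ {x} → ¬ P x → height x ≡ suc (height (f x))
      height-step {x} ¬px with height x in eq
      ... | zero  = ⊥-elim (¬px (subst (λ k → P ((f ^ k) x)) eq (height-reaches x)))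
      ... | suc k = cong suc (ℕP.≤-antisym k≤ ≤k)
        where
        k≤ : k ≤ height (f x)
        k≤ = ℕ.s≤s⁻¹ (subst (_≤ suc (height (f x))) eq (height-minimal x (suc (height (f x)))
               (subst P (sym (^-suc-inner (height (f x)) x)) (height-reaches (f x)))))
        ≤k : height (f x) ≤ k
        ≤k = height-minimal (f x) k (subst P (^-suc-inner k x)
               (subst (λ i → P ((f ^ i) x)) eq (height-reaches x)))

      below-height : ∀ {i} x → i < height x → ¬ P ((f ^ i) x)
      below-height {i} x i<h p = ℕP.<⇒≱ i<h (height-minimal x i p)

      height-^ : ∀ i x → i ≤ height x → height ((f ^ i) x) + i ≡ height x
      height-^ zero    x _   = ℕP.+-identityʳ _
      height-^ (suc i) x i<h = begin
        height (f y) + suc i   ≡⟨ ℕP.+-suc _ i ⟩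
        suc (height (f y)) + i ≡⟨ cong (_+ i) (height-step (below-height x i<h)) ⟨
        height y + i           ≡⟨ height-^ i x (ℕP.<⇒≤ i<h) ⟩
        height x               ∎
        where
        y : A
        y = (f ^ i) x

      ^-injective-below-height : ∀ {i j} x → i ≤ height x → j ≤ height x →
                                 (f ^ i) x ≡ (f ^ j) x → i ≡ j
      ^-injective-below-height {i} {j} x i≤h j≤h eq = ℕP.+-cancelˡ-≡ (height ((f ^ i) x)) i j (begin
        height ((f ^ i) x) + i ≡⟨ height-^ i x i≤h ⟩
        height x               ≡⟨ height-^ j x j≤h ⟨
        height ((f ^ j) x) + j ≡⟨ cong (λ y → height y + j) eq ⟨
        height ((f ^ i) x) + j ∎)

module FinIteration {n} (f : Fin n → Fin n) {P : Pred (Fin n) 0ℓ} (P? : Decidable P)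
                    (fixes : ∀ {x} → P x → f x ≡ x) where
  open import Function.Endo.Propositional (Fin n) using (_^_)
  open Iteration f
  open Absorbing fixes

  eventually-periodic : ∀ x → ¬ P ((f ^ n) x) →
                        Σ[ z ∈ Fin n ] Σ[ L ∈ ℕ ] ¬ P z × (f ^ suc L) z ≡ z
  eventually-periodic x ¬p with FinP.pigeonhole (ℕP.n<1+n n) (λ i → (f ^ toℕ i) x)
  ... | i , j , i<j , same with ℕP.m≤n⇒∃[o]m+o≡n i<j
  ... | L , i+1+L≡j = (f ^ toℕ i) x , L , avoids , period
    where
    avoids : ¬ P ((f ^ toℕ i) x)
    avoids p = ¬p (stays-in x p (ℕP.≤-pred (FinP.toℕ<n i)))
    period : (f ^ suc L) ((f ^ toℕ i) x) ≡ (f ^ toℕ i) x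
    period = begin
      (f ^ suc L) ((f ^ toℕ i) x) ≡⟨ ^-+ (suc L) (toℕ i) x ⟨
      (f ^ (suc L + toℕ i)) x     ≡⟨ cong (λ k → (f ^ k) x)
                                      (trans (ℕP.+-comm (suc L) (toℕ i)) (trans (ℕP.+-suc (toℕ i) L) i+1+L≡j)) ⟩
      (f ^ toℕ j) x               ≡⟨ same ⟨
      (f ^ toℕ i) x               ∎

  absorbed-within-size : (∀ x → ∃[ k ] P ((f ^ k) x)) → ∀ x → P ((f ^ n) x)
  absorbed-within-size reaches x with P? ((f ^ n) x)
  ... | yes p = p
  ... | no ¬p with eventually-periodic x ¬p
  ... | z , L , ¬pz , per with reaches z
  ...   | k , pk = ⊥-elim (periodic-avoids {L} ¬pz per k pk)

other-involutive : ∀ k → other (other k) ≡ k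
other-involutive zero       = refl
other-involutive (suc zero) = refl

other-≢ : ∀ k → other k ≢ k
other-≢ zero       ()
other-≢ (suc zero) ()

same-or-other : ∀ (k s : Fin 2) → k ≡ s ⊎ k ≡ other s
same-or-other zero       zero       = inj₁ refl
same-or-other zero       (suc zero) = inj₂ refl
same-or-other (suc zero) zero       = inj₂ refl
same-or-other (suc zero) (suc zero) = inj₁ refl

module _ (G : BidirectedGraph) where
  open BidirectedGraph G

  module _ {F : Subset m} where

    Connected-trans : ∀ {x y z} → Connected G F x y → Connected G F y z → Connected G F x z
    Connected-trans here          yz = yz
    Connected-trans (there e∈F c) yz = there e∈F (Connected-trans c yz)

    Connected-edge : ∀ {e} k → e ∈ F → Connected G F (end e k) (end e (other k))
    Connected-edge k e∈F = there e∈F here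

    Connected-edge⁻ : ∀ {e} k → e ∈ F → Connected G F (end e (other k)) (end e k)
    Connected-edge⁻ {e} k e∈F =
      subst (Connected G F (end e (other k)) ∘ end e) (other-involutive k) (Connected-edge (other k) e∈F)

    Connected-sym : ∀ {x y} → Connected G F x y → Connected G F y x
    Connected-sym here                   = here
    Connected-sym (there {k = k} e∈F c) = Connected-trans (Connected-sym c) (Connected-edge⁻ k e∈F)

    Connected-mono : ∀ {F′ : Subset m} → F ⊆ F′ → ∀ {x y} → Connected G F x y → Connected G F′ x y
    Connected-mono F⊆F′ here          = here
    Connected-mono F⊆F′ (there e∈F c) = there (F⊆F′ e∈F) (Connected-mono F⊆F′ c)

    record ClosedTrail : Set where
      field
        len              : ℕ
        edgeAt           : ℕ → Fin m
        sideAt           : ℕ → Fin 2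
        vertexAt         : ℕ → Vertex G
        inF              : ∀ t → t ≤ len → edgeAt t ∈ F
        leaves           : ∀ t → t ≤ len → end (edgeAt t) (sideAt t) ≡ vertexAt t
        enters           : ∀ t → t < len → end (edgeAt t) (other (sideAt t)) ≡ vertexAt (suc t)
        closes           : end (edgeAt len) (other (sideAt len)) ≡ vertexAt 0
        edge-injective   : ∀ {t t′} → t ≤ len → t′ ≤ len → edgeAt t ≡ edgeAt t′ → t ≡ t′
        vertex-injective : ∀ {t t′} → t ≤ len → t′ ≤ len → vertexAt t ≡ vertexAt t′ → t ≡ t′

    closedTrail⇒cycle : ClosedTrail → Cycle G F
    closedTrail⇒cycle T = record
      { len      = len
      ; edgeAt   = edgeAt ∘ toℕ
      ; sideAt   = sideAt ∘ toℕ
      ; inF      = λ i → inF (toℕ i) (bounded i)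
      ; edgeInj  = λ {i} {j} eq → FinP.toℕ-injective (edge-injective (bounded i) (bounded j) eq)
      ; vtxInj   = λ {i} {j} eq → FinP.toℕ-injective (vertex-injective (bounded i) (bounded j)
                     (trans (sym (leaves _ (bounded i))) (trans eq (leaves _ (bounded j)))))
      ; consec   = λ i → trans (cong (λ t → end (edgeAt t) (other (sideAt t))) (FinP.toℕ-inject₁ i))
                     (trans (enters (toℕ i) (FinP.toℕ<n i)) (sym (leaves _ (FinP.toℕ<n i))))
      ; closed   = trans (cong (λ t → end (edgeAt t) (other (sideAt t))) (FinP.toℕ-fromℕ len))
                     (trans closes (sym (leaves 0 z≤n)))
      }
      where
      open ClosedTrail T
      bounded : ∀ (i : Fin (suc len)) → toℕ i ≤ len
      bounded i = ℕP.≤-pred (FinP.toℕ<n i)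

  flipKind : Kind G → Kind G
  flipKind adjacency = backstep
  flipKind backstep  = adjacency

  adjacency≢backstep : _≢_ {A = Kind G} adjacency backstep
  adjacency≢backstep ()

  flipKind-≢ : ∀ k → k ≢ flipKind k
  flipKind-≢ adjacency ()
  flipKind-≢ backstep  ()

  kinds-agree : ∀ {k k′ : Kind G} → (k ≡ adjacency → k′ ≡ adjacency) → (k′ ≡ adjacency → k ≡ adjacency) →
                k ≡ k′
  kinds-agree {adjacency} {adjacency} _ _ = refl
  kinds-agree {backstep}  {backstep}  _ _ = refl
  kinds-agree {adjacency} {backstep}  to _ with to refl
  ... | ()
  kinds-agree {backstep}  {adjacency} _ from with from refl
  ... | ()

  module _ {v : Vertex G} where

    opposite : Step G v → Vertex G
    opposite s = end (Step.edge s) (other (Step.side s))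

    headOf-adjacency : ∀ (s : Step G v) → Step.kind s ≡ adjacency → headOf G s ≡ opposite s
    headOf-adjacency (step adjacency _ _ _) refl = refl

    headOf-backstep : ∀ (s : Step G v) → Step.kind s ≡ backstep → headOf G s ≡ v
    headOf-backstep (step backstep _ _ _) refl = refl

    toggle : Step G v → Step G v
    toggle (step k e s at) = step (flipKind k) e s at

  module _ {F : Subset m} (C : Cycle G F) where
    open Cycle C

    cycleVertex : Fin (suc len) → Vertex G
    cycleVertex i = end (edgeAt i) (sideAt i)

    cycle-successor : ∀ t → ∃[ t′ ] end (edgeAt t) (other (sideAt t)) ≡ cycleVertex t′
    cycle-successor t with view t
    ... | ‵fromℕ     = zero , closed
    ... | ‵inject₁ i = suc i , consec i

    cycle-predecessor : ∀ t → ∃[ t′ ] end (edgeAt t′) (other (sideAt t′)) ≡ cycleVertex t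
    cycle-predecessor zero    = fromℕ len , closed
    cycle-predecessor (suc i) = inject₁ i , consec i

module Correspondence (G : BidirectedGraph) (u₁ u₂ w₁ w₂ : Vertex G)
                      (u₁≢u₂ : u₁ ≢ u₂) (w₁≢w₂ : w₁ ≢ w₂) where
  open BidirectedGraph G
  open import Function.Endo.Propositional (Vertex G) using (_^_)

  Assign : Set
  Assign = Assignment G u₁ u₂ w₁ w₂

  πₐ : Assign → Vertex G → Vertex G
  πₐ = π G u₁ u₂ w₁ w₂

  InU : Vertex G → Set
  InU x = x ≡ u₁ ⊎ x ≡ u₂

  inU? : Decidable InU
  inU? x = (x ≟ u₁) ⊎-dec (x ≟ u₂)

  stepAt : Assign → (v : Vertex G) → ¬ InU v → Step G v
  stepAt c v v∉U = c v (v∉U ∘ inj₁) (v∉U ∘ inj₂)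

  kindAt : Assign → (v : Vertex G) → ¬ InU v → Kind G
  kindAt c v v∉U = Step.kind (stepAt c v v∉U)

  TailEq : Assign → Assign → Set
  TailEq = TailEquivalent G u₁ u₂ w₁ w₂

  π-u₁ : ∀ c → πₐ c u₁ ≡ w₁
  π-u₁ c with u₁ ≟ u₁
  ... | yes _ = refl
  ... | no ¬p = ⊥-elim (¬p refl)

  π-u₂ : ∀ c → πₐ c u₂ ≡ w₂
  π-u₂ c with u₂ ≟ u₁ | u₂ ≟ u₂
  ... | yes u₂≡u₁ | _     = ⊥-elim (u₁≢u₂ (sym u₂≡u₁))
  ... | no _      | yes _ = refl
  ... | no _      | no ¬p = ⊥-elim (¬p refl)

  π-outside : ∀ c {x} (x∉U : ¬ InU x) → πₐ c x ≡ headOf G (stepAt c x x∉U)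
  π-outside c {x} x∉U with x ≟ u₁ | x ≟ u₂
  ... | yes x≡u₁ | _        = ⊥-elim (x∉U (inj₁ x≡u₁))
  ... | no _     | yes x≡u₂ = ⊥-elim (x∉U (inj₂ x≡u₂))
  ... | no _     | no _     = refl

  π-cong : ∀ c d x → (∀ x∉U → headOf G (stepAt c x x∉U) ≡ headOf G (stepAt d x x∉U)) → πₐ c x ≡ πₐ d x
  π-cong c d x same with inU? x
  ... | yes (inj₁ refl) = trans (π-u₁ c) (sym (π-u₁ d))
  ... | yes (inj₂ refl) = trans (π-u₂ c) (sym (π-u₂ d))
  ... | no x∉U          = trans (π-outside c x∉U) (trans (same x∉U) (sym (π-outside d x∉U)))

  parent : Assign → Vertex G → Vertex G
  parent c v with inU? v
  ... | yes _    = v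
  ... | no v∉U = opposite G (stepAt c v v∉U)

  parent-fixes : ∀ c {x} → InU x → parent c x ≡ x
  parent-fixes c {x} x∈U with inU? x
  ... | yes _    = refl
  ... | no x∉U = ⊥-elim (x∉U x∈U)

  parent-outside : ∀ c {x} (x∉U : ¬ InU x) → parent c x ≡ opposite G (stepAt c x x∉U)
  parent-outside c {x} x∉U with inU? x
  ... | yes x∈U = ⊥-elim (x∉U x∈U)
  ... | no _    = refl

  π-adjacency : ∀ c {x} (x∉U : ¬ InU x) → kindAt c x x∉U ≡ adjacency → πₐ c x ≡ parent c x
  π-adjacency c x∉U adj = trans (π-outside c x∉U)
    (trans (headOf-adjacency G (stepAt c _ x∉U) adj) (sym (parent-outside c x∉U)))

  π-backstep : ∀ c {x} (x∉U : ¬ InU x) → kindAt c x x∉U ≡ backstep → πₐ c x ≡ x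
  π-backstep c x∉U back = trans (π-outside c x∉U) (headOf-backstep G (stepAt c _ x∉U) back)

  parent-tail-equivalent : ∀ c d → TailEq c d → ∀ v → parent c v ≡ parent d v
  parent-tail-equivalent c d te v with inU? v
  ... | yes _    = refl
  ... | no v∉U = cong (λ (e , k) → end e (other k)) (te v (v∉U ∘ inj₁) (v∉U ∘ inj₂))

  ^-tail-equivalent : ∀ c d → TailEq c d → ∀ i v → (parent c ^ i) v ≡ (parent d ^ i) v
  ^-tail-equivalent c d te zero    v = refl
  ^-tail-equivalent c d te (suc i) v =
    trans (cong (parent c) (^-tail-equivalent c d te i v)) (parent-tail-equivalent c d te ((parent d ^ i) v))

  Rooted : Assign → Set
  Rooted c = ∀ v → InU ((parent c ^ n) v)

  root : Assign → Vertex G → Vertex G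
  root c = parent c ^ n

  OnRootPath : Assign → Vertex G → Set
  OnRootPath c v = ∃[ i ] ((parent c ^ i) w₁ ≡ v ⊎ (parent c ^ i) w₂ ≡ v)

  OnRootPathWithin : Assign → Vertex G → Set
  OnRootPathWithin c v = Σ[ i ∈ Fin (suc n) ] ((parent c ^ toℕ i) w₁ ≡ v ⊎ (parent c ^ toℕ i) w₂ ≡ v)

  onRootPathWithin? : ∀ c v → Dec (OnRootPathWithin c v)
  onRootPathWithin? c v = FinP.any? (λ i → ((parent c ^ toℕ i) w₁ ≟ v) ⊎-dec ((parent c ^ toℕ i) w₂ ≟ v))

  module ParentMap (c : Assign) where
    open Iteration (parent c) public
    open Absorbing (parent-fixes c) public
    open FinIteration (parent c) inU? (parent-fixes c) public

  root-U : ∀ c {u} → InU u → root c u ≡ u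
  root-U c u∈U = ParentMap.^-fixes c u∈U n

  module RootedParent (c : Assign) (rooted : Rooted c) where
    open ParentMap c public
    open Height inU? (λ v → n , rooted v) public

    no-fixed-point-outside : ∀ {x} → ¬ InU x → parent c x ≡ x → ⊥
    no-fixed-point-outside {x} x∉U fixed = periodic-avoids {0} x∉U fixed n (rooted x)

    root-height : ∀ v → root c v ≡ (parent c ^ height v) v
    root-height v = landing-unique n (height v) v (rooted v) (height-reaches v)

    onRootPath-within : ∀ {v} → ¬ InU v → OnRootPath c v → OnRootPathWithin c v
    onRootPath-within {v} v∉U (i , hit) with ℕP.≤-total i n
    ... | inj₁ i≤n = Fin.fromℕ< (s≤s i≤n) ,
                     subst (λ k → (parent c ^ k) w₁ ≡ v ⊎ (parent c ^ k) w₂ ≡ v) (sym (FinP.toℕ-fromℕ< (s≤s i≤n))) hit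
    ... | inj₂ n≤i with hit
    ...   | inj₁ refl = ⊥-elim (v∉U (stays-in w₁ (rooted w₁) n≤i))
    ...   | inj₂ refl = ⊥-elim (v∉U (stays-in w₂ (rooted w₂) n≤i))

    onRootPath? : ∀ {v} → ¬ InU v → Dec (OnRootPath c v)
    onRootPath? {v} v∉U with onRootPathWithin? c v
    ... | yes (i , hit) = yes (toℕ i , hit)
    ... | no ¬within    = no (¬within ∘ onRootPath-within v∉U)

  module RootedContributor (c : Assign) (c-bij : IsContributor G u₁ u₂ w₁ w₂ c) (rooted : Rooted c) where
    open RootedParent c rooted

    private
      π-injective : ∀ {x y} → πₐ c x ≡ πₐ c y → x ≡ y
      π-injective = proj₁ c-bij

    adjacent-above : ∀ {u w} → InU u → πₐ c u ≡ w →
                     ∀ i (x∉U : ¬ InU ((parent c ^ i) w)) → kindAt c _ x∉U ≡ adjacency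
    adjacent-above u∈U πu≡w zero w∉U with kindAt c _ w∉U in eq
    ... | adjacency = refl
    ... | backstep  = ⊥-elim (w∉U (subst InU (π-injective (trans πu≡w (sym (π-backstep c w∉U eq)))) u∈U))
    adjacent-above {w = w} u∈U πu≡w (suc i) y∉U with kindAt c _ y∉U in eq
    ... | adjacency = refl
    ... | backstep  = ⊥-elim (no-fixed-point-outside x∉U (π-injective
                        (trans (π-backstep c y∉U eq) (sym (π-adjacency c x∉U (adjacent-above u∈U πu≡w i x∉U))))))
      where
      x∉U : ¬ InU ((parent c ^ i) w)
      x∉U x∈U = y∉U (subst InU (sym (parent-fixes c x∈U)) x∈U)

    on-root-path⇒adjacency : ∀ {v} (v∉U : ¬ InU v) → OnRootPath c v → kindAt c v v∉U ≡ adjacency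
    on-root-path⇒adjacency v∉U (i , inj₁ refl) = adjacent-above (inj₁ refl) (π-u₁ c) i v∉U
    on-root-path⇒adjacency v∉U (i , inj₂ refl) = adjacent-above (inj₂ refl) (π-u₂ c) i v∉U

    private
      AdjacentOffPath : Vertex G → Set
      AdjacentOffPath z = Σ (¬ InU z) λ z∉U → kindAt c z z∉U ≡ adjacency × ¬ OnRootPath c z

      adjacent-child : ∀ {z} → AdjacentOffPath z → ∃[ y ] AdjacentOffPath y × parent c y ≡ z
      adjacent-child {z} (z∉U , adj , off) with proj₂ c-bij z
      ... | y , πy≡z with πy≡z refl | inU? y
      ... | e | yes (inj₁ refl) = ⊥-elim (off (0 , inj₁ (trans (sym (π-u₁ c)) e)))
      ... | e | yes (inj₂ refl) = ⊥-elim (off (0 , inj₂ (trans (sym (π-u₂ c)) e)))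
      ... | e | no y∉U with kindAt c y y∉U in eq
      ...   | adjacency = y , (y∉U , eq , off-y) , py≡z
        where
        py≡z : parent c y ≡ z
        py≡z = trans (sym (π-adjacency c y∉U eq)) e
        off-y : ¬ OnRootPath c y
        off-y (i , inj₁ hit) = off (suc i , inj₁ (trans (cong (parent c) hit) py≡z))
        off-y (i , inj₂ hit) = off (suc i , inj₂ (trans (cong (parent c) hit) py≡z))
      -- a backstep at y would make y = z both a backstep and an adjacency
      ...   | backstep with trans (sym (π-backstep c y∉U eq)) e
      ...     | refl with trans (sym eq) adj
      ...       | ()

      adjacent-descendants : ∀ {v} → AdjacentOffPath v → ∀ t → ∃[ z ] AdjacentOffPath z × (parent c ^ t) z ≡ v
      adjacent-descendants a zero    = _ , a , refl
      adjacent-descendants a (suc t) with adjacent-descendants a t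
      ... | z , az , eq with adjacent-child az
      ... | y , ay , py≡z = y , ay , trans (^-suc-inner t y) (trans (cong (parent c ^ t) py≡z) eq)

    -- π is onto, so an adjacent vertex off the root paths has such a vertex as a child, and so on;
    -- after n generations this contradicts rootedness.
    adjacency⇒on-root-path : ∀ {v} (v∉U : ¬ InU v) → kindAt c v v∉U ≡ adjacency → OnRootPath c v
    adjacency⇒on-root-path v∉U adj with onRootPath? v∉U
    ... | yes on = on
    ... | no off with adjacent-descendants (v∉U , adj , off) n
    ...   | z , _ , eq = ⊥-elim (v∉U (subst InU eq (rooted z)))

    private
      π-climbs : ∀ {u w} → InU u → πₐ c u ≡ w → ∀ {i} → i < height w →
                 πₐ c ((parent c ^ i) w) ≡ (parent c ^ suc i) w
      π-climbs u∈U πu≡w {i} i<h =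
        π-adjacency c (below-height _ i<h) (adjacent-above u∈U πu≡w i (below-height _ i<h))

      -- π maps u₁ to w₁ and then climbs the path of w₁ (likewise for u₂, w₂); by injectivity
      -- of π, the two paths could only meet if they met one step earlier.
      paths-disjoint : ∀ i j → i ≤ height w₁ → j ≤ height w₂ → (parent c ^ i) w₁ ≢ (parent c ^ j) w₂
      paths-disjoint zero    zero    _   _   = w₁≢w₂
      paths-disjoint zero    (suc j) _   j<h eq = below-height w₂ j<h (inj₁ (π-injective (begin
        πₐ c ((parent c ^ j) w₂) ≡⟨ π-climbs (inj₂ refl) (π-u₂ c) j<h ⟩
        (parent c ^ suc j) w₂    ≡⟨ eq ⟨
        w₁                       ≡⟨ π-u₁ c ⟨
        πₐ c u₁                  ∎)))
      paths-disjoint (suc i) zero    i<h _   eq = below-height w₁ i<h (inj₂ (π-injective (begin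
        πₐ c ((parent c ^ i) w₁) ≡⟨ π-climbs (inj₁ refl) (π-u₁ c) i<h ⟩
        (parent c ^ suc i) w₁    ≡⟨ eq ⟩
        w₂                       ≡⟨ π-u₂ c ⟨
        πₐ c u₂                  ∎)))
      paths-disjoint (suc i) (suc j) i<h j<h eq = paths-disjoint i j (ℕP.<⇒≤ i<h) (ℕP.<⇒≤ j<h)
        (π-injective (trans (π-climbs (inj₁ refl) (π-u₁ c) i<h) (trans eq (sym (π-climbs (inj₂ refl) (π-u₂ c) j<h)))))

    abstract
      roots-differ : root c w₁ ≢ root c w₂
      roots-differ eq = paths-disjoint (height w₁) (height w₂) ℕP.≤-refl ℕP.≤-refl
        (trans (sym (root-height w₁)) (trans eq (root-height w₂)))

  TailEq-sym : ∀ {c d} → TailEq c d → TailEq d c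
  TailEq-sym c~d v p q = sym (c~d v p q)

  rooted-tail-equivalent : ∀ c d → TailEq c d → Rooted c → Rooted d
  rooted-tail-equivalent c d c~d rooted v = subst InU (^-tail-equivalent c d c~d n v) (rooted v)

  onRootPath-tail-equivalent : ∀ c d → TailEq c d → ∀ {v} → OnRootPath c v → OnRootPath d v
  onRootPath-tail-equivalent c d c~d (i , inj₁ hit) = i , inj₁ (trans (sym (^-tail-equivalent c d c~d i w₁)) hit)
  onRootPath-tail-equivalent c d c~d (i , inj₂ hit) = i , inj₂ (trans (sym (^-tail-equivalent c d c~d i w₂)) hit)

  roots-split : ∀ c → Rooted c → root c w₁ ≢ root c w₂ →
                (root c w₁ ≡ u₁ × root c w₂ ≡ u₂) ⊎ (root c w₁ ≡ u₂ × root c w₂ ≡ u₁)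
  roots-split c rooted differ with rooted w₁ | rooted w₂
  ... | inj₁ r₁ | inj₂ r₂ = inj₁ (r₁ , r₂)
  ... | inj₂ r₁ | inj₁ r₂ = inj₂ (r₁ , r₂)
  ... | inj₁ r₁ | inj₁ r₂ = ⊥-elim (differ (trans r₁ (sym r₂)))
  ... | inj₂ r₁ | inj₂ r₂ = ⊥-elim (differ (trans r₁ (sym r₂)))

  kindFor : ∀ {A : Set} → Dec A → Kind G
  kindFor (yes _) = adjacency
  kindFor (no _)  = backstep

  canonical : Assign → Assign
  canonical c v p q = record (c v p q) { kind = kindFor (onRootPathWithin? c v) }

  canonical-tail-equivalent : ∀ c → TailEq c (canonical c)
  canonical-tail-equivalent c v p q = refl

  module Canonical (c : Assign) (rooted : Rooted c) (differ : root c w₁ ≢ root c w₂) where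
    open RootedParent c rooted

    private
      d : Assign
      d = canonical c

      U-on-root-path : ∀ {u} → InU u → OnRootPath c u
      U-on-root-path u∈U with roots-split c rooted differ | u∈U
      ... | inj₁ (r₁ , _) | inj₁ refl = n , inj₁ r₁
      ... | inj₁ (_ , r₂) | inj₂ refl = n , inj₂ r₂
      ... | inj₂ (_ , r₂) | inj₁ refl = n , inj₂ r₂
      ... | inj₂ (r₁ , _) | inj₂ refl = n , inj₁ r₁

    canonical-adjacency⇒ : ∀ {v} (v∉U : ¬ InU v) → kindAt d v v∉U ≡ adjacency → OnRootPath c v
    canonical-adjacency⇒ {v} v∉U adj with onRootPathWithin? c v
    ... | yes (i , hit) = toℕ i , hit

    canonical-adjacency⇐ : ∀ {v} (v∉U : ¬ InU v) → OnRootPath c v → kindAt d v v∉U ≡ adjacency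
    canonical-adjacency⇐ {v} v∉U on with onRootPathWithin? c v
    ... | yes _     = refl
    ... | no ¬within = ⊥-elim (¬within (onRootPath-within v∉U on))

    private
      π-on-path : ∀ {x} (x∉U : ¬ InU x) → OnRootPath c x → πₐ d x ≡ parent c x
      π-on-path {x} x∉U on = trans (π-adjacency d x∉U (canonical-adjacency⇐ x∉U on))
                                   (sym (parent-tail-equivalent c d (canonical-tail-equivalent c) x))

      π-off-path : ∀ {x} (x∉U : ¬ InU x) → ¬ OnRootPath c x → πₐ d x ≡ x
      π-off-path {x} x∉U off = π-backstep d x∉U backstep-here
        where
        backstep-here : kindAt d x x∉U ≡ backstep
        backstep-here with onRootPathWithin? c x
        ... | yes (i , hit) = ⊥-elim (off (toℕ i , hit))
        ... | no _          = refl

      OnPathAt : ℕ → Vertex G → Set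
      OnPathAt i y = (parent c ^ i) w₁ ≡ y ⊎ (parent c ^ i) w₂ ≡ y

      one-step-below : ∀ i {y} → OnPathAt (suc i) y → ∃[ x ] OnPathAt i x × parent c x ≡ y
      one-step-below i (inj₁ refl) = _ , inj₁ refl , refl
      one-step-below i (inj₂ refl) = _ , inj₂ refl , refl

      on-path-hit : ∀ i {y} → OnPathAt i y → ∃[ x ] πₐ d x ≡ y
      on-path-hit zero (inj₁ refl) = u₁ , π-u₁ d
      on-path-hit zero (inj₂ refl) = u₂ , π-u₂ d
      on-path-hit (suc i) hit with one-step-below i hit
      ... | x , x-on , px≡y = case inU? x of λ where
        (yes x∈U) → on-path-hit i (subst (OnPathAt i) (trans (sym (parent-fixes c x∈U)) px≡y) x-on)
        (no x∉U)  → x , trans (π-on-path x∉U (i , x-on)) px≡y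

    abstract
      canonical-contributor : IsContributor G u₁ u₂ w₁ w₂ d
      canonical-contributor = surjective⇒bijective hit
        where
        hit : ∀ y → ∃[ x ] πₐ d x ≡ y
        hit y with inU? y
        ... | yes y∈U = on-path-hit (proj₁ (U-on-root-path y∈U)) (proj₂ (U-on-root-path y∈U))
        ... | no y∉U with onRootPath? y∉U
        ...   | yes (i , on) = on-path-hit i on
        ...   | no off       = y , π-off-path y∉U off

    abstract
      canonical-single-class : SingleClass G u₁ u₂ w₁ w₂ d
      canonical-single-class e e-bij d~e v p q = kinds-agree G d⇒e e⇒d , cong proj₁ (d~e v p q) , cong proj₂ (d~e v p q)
        where
        v∉U : ¬ InU v
        v∉U = [ p , q ]′
        module E = RootedContributor e e-bij (rooted-tail-equivalent c e d~e rooted)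
        d⇒e : kindAt d v v∉U ≡ adjacency → kindAt e v v∉U ≡ adjacency
        d⇒e = E.on-root-path⇒adjacency v∉U ∘ onRootPath-tail-equivalent c e d~e ∘ canonical-adjacency⇒ v∉U
        e⇒d : kindAt e v v∉U ≡ adjacency → kindAt d v v∉U ≡ adjacency
        e⇒d = canonical-adjacency⇐ v∉U ∘ onRootPath-tail-equivalent e c (TailEq-sym {c} {e} d~e)
            ∘ E.adjacency⇒on-root-path v∉U

  kindAt-cong : ∀ c {x y} → x ≡ y → (x∉U : ¬ InU x) (y∉U : ¬ InU y) → kindAt c x x∉U ≡ kindAt c y y∉U
  kindAt-cong c refl _ _ = refl

  -- A periodic point z ∉ U of the parent map: along its orbit all steps have the same kind,
  -- and toggling them gives another contributor with the same tails.
  module Flip (c : Assign) (c-bij : IsContributor G u₁ u₂ w₁ w₂ c)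
              {z : Vertex G} {L : ℕ} (z∉U : ¬ InU z) (period : (parent c ^ suc L) z ≡ z) where
    open ParentMap c

    orbit-outside : ∀ t → ¬ InU ((parent c ^ t) z)
    orbit-outside = periodic-avoids {L} z∉U period

    OnOrbit : Vertex G → Set
    OnOrbit y = ∃[ t ] (parent c ^ t) z ≡ y

    private
      ^-mod : ∀ s → (parent c ^ (s % suc L)) z ≡ (parent c ^ s) z
      ^-mod s = begin
        (parent c ^ r) z                    ≡⟨ cong (parent c ^ r) (^-period-multiple period q) ⟨
        (parent c ^ r) ((parent c ^ (q * suc L)) z) ≡⟨ ^-+ r (q * suc L) z ⟨
        (parent c ^ (r + q * suc L)) z      ≡⟨ cong (λ k → (parent c ^ k) z) (m≡m%n+[m/n]*n s (suc L)) ⟨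
        (parent c ^ s) z                    ∎
        where
        r q : ℕ
        r = s % suc L
        q = s / suc L

    onOrbit? : ∀ y → Dec (OnOrbit y)
    onOrbit? y with FinP.any? (λ (t : Fin (suc L)) → (parent c ^ toℕ t) z ≟ y)
    ... | yes (t , hit) = yes (toℕ t , hit)
    ... | no miss       = no λ (s , hit) → miss (Fin.fromℕ< (m%n<n s (suc L)) ,
                            trans (cong (λ k → (parent c ^ k) z) (FinP.toℕ-fromℕ< (m%n<n s (suc L)))) (trans (^-mod s) hit))

    orbitKind : ℕ → Kind G
    orbitKind t = kindAt c _ (orbit-outside t)

    private
      orbitKind-cong : ∀ a b → (parent c ^ a) z ≡ (parent c ^ b) z → orbitKind a ≡ orbitKind b
      orbitKind-cong a b eq = kindAt-cong c eq (orbit-outside a) (orbit-outside b)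

      adjacency-propagates : ∀ t → orbitKind t ≡ adjacency → orbitKind (suc t) ≡ adjacency
      adjacency-propagates t adj with orbitKind (suc t) in back
      ... | adjacency = refl
      ... | backstep  = ⊥-elim (adjacency≢backstep G (trans (sym adj) (trans (orbitKind-cong t (suc t) x≡px) back)))
        where
        x≡px : (parent c ^ t) z ≡ (parent c ^ suc t) z
        x≡px = proj₁ c-bij (trans (π-adjacency c (orbit-outside t) adj) (sym (π-backstep c (orbit-outside (suc t)) back)))

      adjacency-propagates-by : ∀ s t → orbitKind t ≡ adjacency → orbitKind (s + t) ≡ adjacency
      adjacency-propagates-by zero    t adj = adj
      adjacency-propagates-by (suc s) t adj = adjacency-propagates (s + t) (adjacency-propagates-by s t adj)

      adjacency-everywhere : ∀ t → orbitKind t ≡ adjacency → ∀ t′ → orbitKind t′ ≡ adjacency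
      adjacency-everywhere t adj t′ = trans (orbitKind-cong t′ (t′ + t * L + t) wrap) (adjacency-propagates-by (t′ + t * L) t adj)
        where
        wrap : (parent c ^ t′) z ≡ (parent c ^ (t′ + t * L + t)) z
        wrap = begin
          (parent c ^ t′) z                              ≡⟨ cong (parent c ^ t′) (^-period-multiple period t) ⟨
          (parent c ^ t′) ((parent c ^ (t * suc L)) z)   ≡⟨ ^-+ t′ (t * suc L) z ⟨
          (parent c ^ (t′ + t * suc L)) z                ≡⟨ cong (λ k → (parent c ^ k) z)
                                                               (solve 3 (λ a b l → a :+ b :* (con 1 :+ l) := a :+ b :* l :+ b) refl t′ t L) ⟩
          (parent c ^ (t′ + t * L + t)) z                ∎

    orbitKind-uniform : ∀ t → orbitKind t ≡ orbitKind 0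
    orbitKind-uniform t with orbitKind 0 in k₀
    ... | adjacency = adjacency-everywhere 0 k₀ t
    ... | backstep with orbitKind t in kₜ
    ...   | backstep  = refl
    ...   | adjacency = ⊥-elim (adjacency≢backstep G (trans (sym (adjacency-everywhere t kₜ 0)) k₀))

    flipped : Assign
    flipped v p q with onOrbit? v
    ... | yes _ = toggle G (c v p q)
    ... | no _  = c v p q

    flipped-tail-equivalent : TailEq c flipped
    flipped-tail-equivalent v p q with onOrbit? v
    ... | yes _ = refl
    ... | no _  = refl

    private
      flipped-on : ∀ {v} → OnOrbit v → (v∉U : ¬ InU v) → stepAt flipped v v∉U ≡ toggle G (stepAt c v v∉U)
      flipped-on {v} on v∉U with onOrbit? v
      ... | yes _  = refl
      ... | no off = ⊥-elim (off on)

      flipped-off : ∀ {v} → ¬ OnOrbit v → (v∉U : ¬ InU v) → stepAt flipped v v∉U ≡ stepAt c v v∉U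
      flipped-off {v} off v∉U with onOrbit? v
      ... | yes on = ⊥-elim (off on)
      ... | no _   = refl

      π-flipped-off : ∀ {x} → ¬ OnOrbit x → πₐ flipped x ≡ πₐ c x
      π-flipped-off {x} off = π-cong flipped c x (λ x∉U → cong (headOf G) (flipped-off off x∉U))

      π-flipped-on : ∀ t → πₐ flipped ((parent c ^ t) z) ≡ headOf G (toggle G (stepAt c _ (orbit-outside t)))
      π-flipped-on t = trans (π-outside flipped (orbit-outside t)) (cong (headOf G) (flipped-on (t , refl) (orbit-outside t)))

      π-flipped-adjacent-orbit : orbitKind 0 ≡ adjacency → ∀ t → πₐ flipped ((parent c ^ t) z) ≡ (parent c ^ t) z
      π-flipped-adjacent-orbit k₀ t = trans (π-flipped-on t)
        (headOf-backstep G (toggle G (stepAt c _ (orbit-outside t))) (cong (flipKind G) (trans (orbitKind-uniform t) k₀)))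

      π-flipped-backstep-orbit : orbitKind 0 ≡ backstep → ∀ t → πₐ flipped ((parent c ^ t) z) ≡ (parent c ^ suc t) z
      π-flipped-backstep-orbit k₀ t = trans (π-flipped-on t)
        (trans (headOf-adjacency G (toggle G (stepAt c _ (orbit-outside t))) (cong (flipKind G) (trans (orbitKind-uniform t) k₀)))
               (sym (parent-outside c (orbit-outside t))))

      π-orbit : ∀ t → OnOrbit (πₐ c ((parent c ^ t) z))
      π-orbit t with orbitKind t in kₜ
      ... | adjacency = suc t , sym (π-adjacency c (orbit-outside t) kₜ)
      ... | backstep  = t , sym (π-backstep c (orbit-outside t) kₜ)

    flipped-contributor : IsContributor G u₁ u₂ w₁ w₂ flipped
    flipped-contributor = surjective⇒bijective hit
      where
      hit : ∀ y → ∃[ x ] πₐ flipped x ≡ y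
      hit y with onOrbit? y
      hit _ | yes (t , refl) with orbitKind 0 in k₀
      ... | adjacency = (parent c ^ t) z , π-flipped-adjacent-orbit k₀ t
      ... | backstep  = (parent c ^ (t + L)) z , (begin
        πₐ flipped ((parent c ^ (t + L)) z) ≡⟨ π-flipped-backstep-orbit k₀ (t + L) ⟩
        (parent c ^ suc (t + L)) z          ≡⟨ cong (λ k → (parent c ^ k) z) (ℕP.+-suc t L) ⟨
        (parent c ^ (t + suc L)) z          ≡⟨ ^-+ t (suc L) z ⟩
        (parent c ^ t) ((parent c ^ suc L) z) ≡⟨ cong (parent c ^ t) period ⟩
        (parent c ^ t) z                    ∎)
      hit y | no off with proj₂ c-bij y
      ... | x , πx≡y = case onOrbit? x of λ where
        (yes (t , refl)) → ⊥-elim (off (subst OnOrbit (πx≡y refl) (π-orbit t)))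
        (no x-off)       → x , trans (π-flipped-off x-off) (πx≡y refl)

    not-single-class : ¬ SingleClass G u₁ u₂ w₁ w₂ c
    not-single-class single = flipKind-≢ G (kindAt c z z∉U)
      (trans (proj₁ (single flipped flipped-contributor flipped-tail-equivalent z (z∉U ∘ inj₁) (z∉U ∘ inj₂)))
             (cong Step.kind (flipped-on (0 , refl) z∉U)))

  abstract
    single-class⇒rooted : ∀ c → IsContributor G u₁ u₂ w₁ w₂ c → SingleClass G u₁ u₂ w₁ w₂ c → Rooted c
    single-class⇒rooted c c-bij single v with inU? ((parent c ^ n) v)
    ... | yes r  = r
    ... | no ¬r with ParentMap.eventually-periodic c v ¬r
    ...   | z , L , z∉U , period = ⊥-elim (Flip.not-single-class c c-bij {z} {L} z∉U period single)

  module TailForest (c : Assign) where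

    Owns : Fin m → Vertex G → Set
    Owns e x = Σ (¬ InU x) λ x∉U → Step.edge (stepAt c x x∉U) ≡ e

    owns? : ∀ e x → Dec (Owns e x)
    owns? e x with inU? x
    ... | yes x∈U = no (λ (x∉U , _) → x∉U x∈U)
    ... | no x∉U  = Dec.map′ (x∉U ,_) proj₂ (Step.edge (stepAt c x x∉U) ≟ e)

    owned? : ∀ e → Dec (∃[ x ] Owns e x)
    owned? e = FinP.any? (owns? e)

    tailForest : Subset m
    tailForest = subset owned?

    tail-∈ : ∀ {x} (x∉U : ¬ InU x) → Step.edge (stepAt c x x∉U) ∈ tailForest
    tail-∈ x∉U = ∈-subset⁺ owned? (_ , x∉U , refl)

    tailForest-owned : ∀ {e} → e ∈ tailForest → ∃[ x ] Owns e x
    tailForest-owned = ∈-subset⁻ owned?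

    OwnedFrom : Fin m → Fin 2 → Set
    OwnedFrom e k = Σ (¬ InU (end e k)) λ ∉U → tailOf G (stepAt c (end e k) ∉U) ≡ (e , k)

    tail-owned : ∀ {x} (x∉U : ¬ InU x) → OwnedFrom (Step.edge (stepAt c x x∉U)) (Step.side (stepAt c x x∉U))
    tail-owned {x} x∉U = subst (λ y → Σ (¬ InU y) λ y∉U → tailOf G (stepAt c y y∉U) ≡ tailOf G (stepAt c x x∉U))
                               (sym (Step.at (stepAt c x x∉U))) (x∉U , refl)

    owned-from-an-end : ∀ {e} → e ∈ tailForest → ∀ k → OwnedFrom e k ⊎ OwnedFrom e (other k)
    owned-from-an-end e∈ k with tailForest-owned e∈
    ... | x , x∉U , refl with same-or-other k (Step.side (stepAt c x x∉U))
    ...   | inj₁ refl = inj₁ (tail-owned x∉U)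
    ...   | inj₂ refl = inj₂ (subst (OwnedFrom _) (sym (other-involutive _)) (tail-owned x∉U))

    owned-parent : ∀ {e k} → OwnedFrom e k → parent c (end e k) ≡ end e (other k)
    owned-parent (∉U , tail≡) = trans (parent-outside c ∉U) (cong (λ (e , k) → end e (other k)) tail≡)

    tail-unique : ∀ {x y} → x ≡ y → (x∉U : ¬ InU x) (y∉U : ¬ InU y) →
                  tailOf G (stepAt c x x∉U) ≡ tailOf G (stepAt c y y∉U)
    tail-unique refl _ _ = refl

    Connected-parent : ∀ y → Connected G tailForest (parent c y) y
    Connected-parent y with inU? y
    ... | yes _   = here
    ... | no y∉U = subst (Connected G tailForest _) (Step.at (stepAt c y y∉U))
                         (Connected-edge⁻ G (Step.side (stepAt c y y∉U)) (tail-∈ y∉U))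

    Connected-^ : ∀ i y → Connected G tailForest ((parent c ^ i) y) y
    Connected-^ zero    y = here
    Connected-^ (suc i) y = Connected-trans G (Connected-parent _) (Connected-^ i y)

    module _ (rooted : Rooted c) where
      open RootedParent c rooted

      owner-taller : ∀ {e k} → OwnedFrom e k → height (end e k) ≡ suc (height (end e (other k)))
      owner-taller o@(∉U , _) = trans (height-step ∉U) (cong (suc ∘ height) (owned-parent o))

      root-parent : ∀ x → root c (parent c x) ≡ root c x
      root-parent x = trans (sym (^-suc-inner n x)) (parent-fixes c (rooted x))

      root-edge : ∀ {e} → e ∈ tailForest → ∀ k → root c (end e k) ≡ root c (end e (other k))
      root-edge {e} e∈ k with owned-from-an-end e∈ k
      ... | inj₁ o = trans (sym (root-parent _)) (cong (root c) (owned-parent o))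
      ... | inj₂ o = trans (cong (root c ∘ end e) (sym (other-involutive k)))
                           (trans (cong (root c) (sym (owned-parent o))) (root-parent _))

      root-connected : ∀ {x y} → Connected G tailForest x y → root c x ≡ root c y
      root-connected here                   = refl
      root-connected (there {k = k} e∈ conn) = trans (root-edge e∈ k) (root-connected conn)

      owner-above : ∀ {e k x y} → OwnedFrom e k → end e (other k) ≡ x → end e k ≡ y → height y ≡ suc (height x)
      owner-above o refl refl = owner-taller o

      highest-cycle-vertex-impossible : (C : Cycle G tailForest) (t : Fin (suc (Cycle.len C))) →
        (∀ i → height (cycleVertex G C i) ≤ height (cycleVertex G C t)) → ⊥
      highest-cycle-vertex-impossible C t highest =
        other-≢ (sideAt t) (sym (trans (cong proj₂ same-tail) (cong (other ∘ sideAt) (sym t≡t′))))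
        where
        open Cycle C
        not-above-t : ∀ i → height (cycleVertex G C i) ≢ suc (height (cycleVertex G C t))
        not-above-t i eq = ℕP.1+n≰n (subst (_≤ height (cycleVertex G C t)) eq (highest i))
        next : Fin (suc len)
        next = proj₁ (cycle-successor G C t)
        t′ : Fin (suc len)
        t′ = proj₁ (cycle-predecessor G C t)
        out-owned : OwnedFrom (edgeAt t) (sideAt t)
        out-owned = [ id , (λ o → ⊥-elim (not-above-t next (owner-above o
                      (cong (end (edgeAt t)) (other-involutive _)) (proj₂ (cycle-successor G C t))))) ]′
                    (owned-from-an-end (inF t) (sideAt t))
        in-owned : OwnedFrom (edgeAt t′) (other (sideAt t′))
        in-owned = [ id , (λ o → ⊥-elim (not-above-t t′ (owner-above o
                     (trans (cong (end (edgeAt t′) ∘ other) (other-involutive _)) (proj₂ (cycle-predecessor G C t)))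
                     (cong (end (edgeAt t′)) (other-involutive _))))) ]′
                   (owned-from-an-end (inF t′) (other (sideAt t′)))
        same-tail : (edgeAt t , sideAt t) ≡ (edgeAt t′ , other (sideAt t′))
        same-tail = trans (sym (proj₂ out-owned))
          (trans (tail-unique (sym (proj₂ (cycle-predecessor G C t))) (proj₁ out-owned) (proj₁ in-owned)) (proj₂ in-owned))
        t≡t′ : t ≡ t′
        t≡t′ = edgeInj (cong proj₁ same-tail)

      tailForest-acyclic : ¬ Cycle G tailForest
      tailForest-acyclic C = highest-cycle-vertex-impossible C _ (proj₂ (argmax (height ∘ cycleVertex G C)))

      abstract
        tailForest-tutte : root c w₁ ≢ root c w₂ → IsTutte2Arborescence G u₁ u₂ w₁ w₂ tailForest
        tailForest-tutte differ = tailForest-acyclic , reach , separated , w-condition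
          where
          from-root : ∀ {v u} → root c v ≡ u → Connected G tailForest u v
          from-root {v} refl = Connected-^ n v
          reach : ∀ v → Connected G tailForest u₁ v ⊎ Connected G tailForest u₂ v
          reach v with rooted v
          ... | inj₁ r = inj₁ (from-root r)
          ... | inj₂ r = inj₂ (from-root r)
          separated : ¬ Connected G tailForest u₁ u₂
          separated conn = u₁≢u₂ (begin
            u₁        ≡⟨ root-U c (inj₁ refl) ⟨
            root c u₁ ≡⟨ root-connected conn ⟩
            root c u₂ ≡⟨ root-U c (inj₂ refl) ⟩
            u₂        ∎)
          w-condition : (Connected G tailForest u₁ w₁ × Connected G tailForest u₂ w₂)
                      ⊎ (Connected G tailForest u₁ w₂ × Connected G tailForest u₂ w₁)
          w-condition with roots-split c rooted differ
          ... | inj₁ (r₁ , r₂) = inj₁ (from-root r₁ , from-root r₂)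
          ... | inj₂ (r₁ , r₂) = inj₂ (from-root r₂ , from-root r₁)

  module Walks (F : Subset m) where

    DownStep : ℕ → Vertex G → Set
    ReachesU : ℕ → Vertex G → Set

    DownStep k y = Σ[ e ∈ Fin m ] Σ[ s ∈ Fin 2 ] e ∈ F × end e s ≡ y × ReachesU k (end e (other s))

    ReachesU zero    y = InU y
    ReachesU (suc k) y = DownStep k y

    reachesU? : ∀ k y → Dec (ReachesU k y)
    reachesU? zero    y = inU? y
    reachesU? (suc k) y = FinP.any? λ e → FinP.any? λ s →
      (e ∈? F) ×-dec ((end e s ≟ y) ×-dec reachesU? k (end e (other s)))

    canonicalWalk : ∀ {k y} → ReachesU k y → ReachesU k y
    canonicalWalk {k} {y} r with reachesU? k y
    ... | yes r′ = r′
    ... | no ¬r  = ⊥-elim (¬r r)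

    canonicalWalk-irrelevant : ∀ {k y} (r r′ : ReachesU k y) → canonicalWalk r ≡ canonicalWalk r′
    canonicalWalk-irrelevant {k} {y} r r′ with reachesU? k y
    ... | yes _ = refl
    ... | no ¬r = ⊥-elim (¬r r)

    reachesU-Connected : ∀ {x y k} → Connected G F x y → ReachesU k x → ∃[ k′ ] ReachesU k′ y
    reachesU-Connected {k = k} here r = k , r
    reachesU-Connected {k = k} (there {e} {s} e∈ conn) r =
      reachesU-Connected conn (e , other s , e∈ , refl , subst (ReachesU k ∘ end e) (sym (other-involutive s)) r)

    firstStep : ∀ {v} k → ReachesU k v → .(v ≢ u₁) → .(v ≢ u₂) → DownStep (ℕ.pred k) v
    firstStep zero    (inj₁ v≡u₁) p q = Irrelevant.⊥-elim (p v≡u₁)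
    firstStep zero    (inj₂ v≡u₂) p q = Irrelevant.⊥-elim (q v≡u₂)
    firstStep (suc k) r           p q = r

    firstTail : ∀ {v} k → ReachesU k v → .(v ≢ u₁) → .(v ≢ u₂) → Fin m × Fin 2
    firstTail k r p q = proj₁ (firstStep k r p q) , proj₁ (proj₂ (firstStep k r p q))

    canonical-firstTail : ∀ {v k k′} → k ≡ k′ → (r : ReachesU k v) (r′ : ReachesU k′ v) → ∀ p q →
                          firstTail k (canonicalWalk r) p q ≡ firstTail k′ (canonicalWalk r′) p q
    canonical-firstTail {k = k} refl r r′ p q = cong (λ w → firstTail k w p q) (canonicalWalk-irrelevant r r′)

  module TreeTails (F : Subset m) (tutte : IsTutte2Arborescence G u₁ u₂ w₁ w₂ F) where
    open Walks F

    private
      acyclic : IsForest G F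
      acyclic = proj₁ tutte

      spanning : ∀ v → Connected G F u₁ v ⊎ Connected G F u₂ v
      spanning = proj₁ (proj₂ tutte)

      separated : ¬ Connected G F u₁ u₂
      separated = proj₁ (proj₂ (proj₂ tutte))

      w-split : (Connected G F u₁ w₁ × Connected G F u₂ w₂) ⊎ (Connected G F u₁ w₂ × Connected G F u₂ w₁)
      w-split = proj₂ (proj₂ (proj₂ tutte))

      reaches-somewhere : ∀ v → ∃[ k ] ReachesU k v
      reaches-somewhere v with spanning v
      ... | inj₁ conn = reachesU-Connected conn (inj₁ refl)
      ... | inj₂ conn = reachesU-Connected conn (inj₂ refl)

      shortest : ∀ v → MinimalWitness (λ k → reachesU? k v)
      shortest v = minimalWitness (λ k → reachesU? k v) (proj₁ (reaches-somewhere v)) (proj₂ (reaches-somewhere v))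

    distance : Vertex G → ℕ
    distance v = proj₁ (shortest v)

    distance-reaches : ∀ v → ReachesU (distance v) v
    distance-reaches v = canonicalWalk (proj₁ (proj₂ (shortest v)))

    distance-minimal : ∀ v k → ReachesU k v → distance v ≤ k
    distance-minimal v = proj₂ (proj₂ (shortest v))

    downStep : ∀ v → .(v ≢ u₁) → .(v ≢ u₂) → DownStep (ℕ.pred (distance v)) v
    downStep v = firstStep (distance v) (distance-reaches v)

    -- Only the tails matter: the kinds are recomputed by `canonical`.
    treeTails : Assign
    treeTails v p q = let (e , s , _ , at , _) = downStep v p q in step backstep e s at

    treeTails-∈ : ∀ {x} (x∉U : ¬ InU x) → Step.edge (stepAt treeTails x x∉U) ∈ F
    treeTails-∈ {x} x∉U = proj₁ (proj₂ (proj₂ (downStep x (x∉U ∘ inj₁) (x∉U ∘ inj₂))))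

    parent-down : ∀ {x} (x∉U : ¬ InU x) → ReachesU (ℕ.pred (distance x)) (parent treeTails x)
    parent-down {x} x∉U = subst (ReachesU _) (sym (parent-outside treeTails x∉U))
                                (proj₂ (proj₂ (proj₂ (proj₂ (downStep x (x∉U ∘ inj₁) (x∉U ∘ inj₂))))))

    distance-parent : ∀ {x} → ¬ InU x → distance x ≡ suc (distance (parent treeTails x))
    distance-parent {x} x∉U = ℕP.≤-antisym
      (distance-minimal x _ (Step.edge tail , Step.side tail , treeTails-∈ x∉U , Step.at tail ,
                             subst (ReachesU _) (parent-outside treeTails x∉U) (distance-reaches _)))
      (subst (suc (distance (parent treeTails x)) ≤_) (ℕP.suc-pred (distance x) {{ℕ.≢-nonZero distance≢0}})
             (s≤s (distance-minimal _ _ (parent-down x∉U))))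
      where
      tail : Step G x
      tail = stepAt treeTails x x∉U
      distance≢0 : distance x ≢ 0
      distance≢0 eq = x∉U (subst (λ k → ReachesU k x) eq (distance-reaches x))

    private
      open ParentMap treeTails

      reaches-within-distance : ∀ k x → distance x ≡ k → InU ((parent treeTails ^ k) x)
      reaches-within-distance zero    x eq = subst (λ k → ReachesU k x) eq (distance-reaches x)
      reaches-within-distance (suc k) x eq = case inU? x of λ where
        (yes x∈U) → subst InU (sym (^-fixes x∈U (suc k))) x∈U
        (no x∉U)  → subst InU (sym (^-suc-inner k x))
                      (reaches-within-distance k _ (ℕP.suc-injective (trans (sym (distance-parent x∉U)) eq)))

    abstract
      treeTails-rooted : Rooted treeTails
      treeTails-rooted = absorbed-within-size (λ x → distance x , reaches-within-distance _ x refl)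

    private
      module T = TailForest treeTails

    tailForest⊆F : T.tailForest ⊆ F
    tailForest⊆F e∈ with T.tailForest-owned e∈
    ... | x , x∉U , refl = treeTails-∈ x∉U

    private
      Connected-root : ∀ v → Connected G F (root treeTails v) v
      Connected-root v = Connected-mono G tailForest⊆F (T.Connected-^ n v)

      roots-joined : ∀ {x y} → Connected G F x y → Connected G F (root treeTails x) (root treeTails y)
      roots-joined {x} {y} conn = Connected-trans G (Connected-root x) (Connected-trans G conn (Connected-sym G (Connected-root y)))

    root-Connected : ∀ {x y} → Connected G F x y → root treeTails x ≡ root treeTails y
    root-Connected {x} {y} conn with treeTails-rooted x | treeTails-rooted y
    ... | inj₁ rx | inj₁ ry = trans rx (sym ry)
    ... | inj₂ rx | inj₂ ry = trans rx (sym ry)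
    ... | inj₁ rx | inj₂ ry = ⊥-elim (separated (subst₂ (Connected G F) rx ry (roots-joined conn)))
    ... | inj₂ rx | inj₁ ry = ⊥-elim (separated (subst₂ (Connected G F) ry rx (roots-joined (Connected-sym G conn))))

    abstract
      treeTails-roots-differ : root treeTails w₁ ≢ root treeTails w₂
      treeTails-roots-differ eq with w-split
      ... | inj₁ (u₁w₁ , u₂w₂) = u₁≢u₂ (begin
        u₁                 ≡⟨ root-U treeTails (inj₁ refl) ⟨
        root treeTails u₁  ≡⟨ root-Connected u₁w₁ ⟩
        root treeTails w₁  ≡⟨ eq ⟩
        root treeTails w₂  ≡⟨ root-Connected u₂w₂ ⟨
        root treeTails u₂  ≡⟨ root-U treeTails (inj₂ refl) ⟩
        u₂                 ∎)
      ... | inj₂ (u₁w₂ , u₂w₁) = u₁≢u₂ (begin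
        u₁                 ≡⟨ root-U treeTails (inj₁ refl) ⟨
        root treeTails u₁  ≡⟨ root-Connected u₁w₂ ⟩
        root treeTails w₂  ≡⟨ eq ⟨
        root treeTails w₁  ≡⟨ root-Connected u₂w₁ ⟨
        root treeTails u₂  ≡⟨ root-U treeTails (inj₂ refl) ⟩
        u₂                 ∎)

    -- An edge e ∈ F owned by no vertex yields a cycle: from a up its parent path to the first
    -- vertex met by the parent path of b, down that path to b, and back to a along e.
    module UnownedEdge {e : Fin m} (e∈F : e ∈ F)
                       (unowned : ∀ {x} (x∉U : ¬ InU x) → Step.edge (stepAt treeTails x x∉U) ≢ e) where
      open RootedParent treeTails treeTails-rooted

      private
        par : Vertex G → Vertex G
        par = parent treeTails

      a b : Vertex G
      a = end e zero
      b = end e (suc zero)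

      private
        MeetsPathOfB : ℕ → Set
        MeetsPathOfB i = Σ[ j ∈ Fin (suc (height b)) ] (par ^ toℕ j) b ≡ (par ^ i) a

        meets-at-roots : MeetsPathOfB (height a)
        meets-at-roots = Fin.fromℕ (height b) , (begin
          (par ^ toℕ (Fin.fromℕ (height b))) b ≡⟨ cong (λ k → (par ^ k) b) (FinP.toℕ-fromℕ (height b)) ⟩
          (par ^ height b) b                   ≡⟨ root-height b ⟨
          root treeTails b                     ≡⟨ root-Connected (Connected-edge G zero e∈F) ⟨
          root treeTails a                     ≡⟨ root-height a ⟩
          (par ^ height a) a                   ∎)

        meetsPathOfB? : ∀ i → Dec (MeetsPathOfB i)
        meetsPathOfB? i = FinP.any? (λ j → (par ^ toℕ j) b ≟ (par ^ i) a)

      abstract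
        first-meeting : MinimalWitness meetsPathOfB?
        first-meeting = minimalWitness meetsPathOfB? (height a) meets-at-roots

        i* j* : ℕ
        i* = proj₁ first-meeting
        j* = toℕ (proj₁ (proj₁ (proj₂ first-meeting)))

        i*-meets : (par ^ j*) b ≡ (par ^ i*) a
        i*-meets = proj₂ (proj₁ (proj₂ first-meeting))

        i*-first : ∀ {i j} → j ≤ height b → (par ^ j) b ≡ (par ^ i) a → i* ≤ i
        i*-first {i} {j} j≤ meets = proj₂ (proj₂ first-meeting) i
          (Fin.fromℕ< (s≤s j≤) , trans (cong (λ k → (par ^ k) b) (FinP.toℕ-fromℕ< (s≤s j≤))) meets)

        i*≤ : i* ≤ height a
        i*≤ = proj₂ (proj₂ first-meeting) (height a) meets-at-roots

        j*≤ : j* ≤ height b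
        j*≤ = ℕP.≤-pred (FinP.toℕ<n (proj₁ (proj₁ (proj₂ first-meeting))))

      len : ℕ
      len = i* + j*

      vertexAt : ℕ → Vertex G
      vertexAt t with t ≤? i*
      ... | yes _ = (par ^ t) a
      ... | no _  = (par ^ (len ∸ t)) b

      vertexAt-a : ∀ {t} → t ≤ i* → vertexAt t ≡ (par ^ t) a
      vertexAt-a {t} t≤i* with t ≤? i*
      ... | yes _   = refl
      ... | no t≰i* = ⊥-elim (t≰i* t≤i*)

      vertexAt-b : ∀ {t} → i* ≤ t → vertexAt t ≡ (par ^ (len ∸ t)) b
      vertexAt-b {t} i*≤t with t ≤? i*
      ... | no _     = refl
      ... | yes t≤i* with ℕP.≤-antisym t≤i* i*≤t
      ...   | refl = trans (sym i*-meets) (cong (λ k → (par ^ k) b) (sym (ℕP.m+n∸m≡n i* j*)))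

      private
        b-index< : ∀ {t} → i* < t → t ≤ len → len ∸ t < j*
        b-index< {t} i*<t t≤len = subst (len ∸ t <_) (ℕP.m+n∸m≡n i* j*) (ℕP.∸-monoʳ-< i*<t t≤len)

        a-path-avoids-b-path : ∀ {t s} → t ≤ i* → s < j* → (par ^ t) a ≢ (par ^ s) b
        a-path-avoids-b-path {t} {s} t≤i* s<j* eq with ℕP.m≤n⇒m<n∨m≡n t≤i*
        ... | inj₁ t<i* = ℕP.<⇒≱ t<i* (i*-first (ℕP.≤-trans (ℕP.<⇒≤ s<j*) j*≤) (sym eq))
        ... | inj₂ refl = ℕP.<⇒≢ s<j* (^-injective-below-height b (ℕP.≤-trans (ℕP.<⇒≤ s<j*) j*≤) j*≤
                            (trans (sym eq) (sym i*-meets)))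

      vertexAt-cases : ∀ t → (t ≤ i* × vertexAt t ≡ (par ^ t) a) ⊎ (i* < t × vertexAt t ≡ (par ^ (len ∸ t)) b)
      vertexAt-cases t with t ≤? i*
      ... | yes t≤i* = inj₁ (t≤i* , refl)
      ... | no t≰i*  = inj₂ (ℕP.≰⇒> t≰i* , refl)

      vertexAt-injective : ∀ {t t′} → t ≤ len → t′ ≤ len → vertexAt t ≡ vertexAt t′ → t ≡ t′
      vertexAt-injective {t} {t′} t≤len t′≤len eq with vertexAt-cases t | vertexAt-cases t′
      ... | inj₁ (t≤i* , vt) | inj₁ (t′≤i* , vt′) =
        ^-injective-below-height a (ℕP.≤-trans t≤i* i*≤) (ℕP.≤-trans t′≤i* i*≤) (trans (sym vt) (trans eq vt′))
      ... | inj₂ (i*<t , vt) | inj₂ (i*<t′ , vt′) = ℕP.∸-cancelˡ-≡ t≤len t′≤len (^-injective-below-height b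
        (ℕP.≤-trans (ℕP.<⇒≤ (b-index< i*<t t≤len)) j*≤) (ℕP.≤-trans (ℕP.<⇒≤ (b-index< i*<t′ t′≤len)) j*≤)
        (trans (sym vt) (trans eq vt′)))
      ... | inj₁ (t≤i* , vt) | inj₂ (i*<t′ , vt′) =
        ⊥-elim (a-path-avoids-b-path t≤i* (b-index< i*<t′ t′≤len) (trans (sym vt) (trans eq vt′)))
      ... | inj₂ (i*<t , vt) | inj₁ (t′≤i* , vt′) =
        ⊥-elim (a-path-avoids-b-path t′≤i* (b-index< i*<t t≤len) (trans (sym vt′) (trans (sym eq) vt)))

      private
        Hop : Vertex G → Vertex G → Set
        Hop x y = Σ (¬ InU x) λ _ → par x ≡ y

        hop-up : ∀ x {k} → k < height x → Hop ((par ^ k) x) ((par ^ suc k) x)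
        hop-up x k<h = below-height x k<h , refl

      hop : ∀ {t} → t < len → Hop (vertexAt t) (vertexAt (suc t)) ⊎ Hop (vertexAt (suc t)) (vertexAt t)
      hop {t} t<len = case t <? i* of λ where
        (yes t<i*) → inj₁ (subst₂ Hop (sym (vertexAt-a (ℕP.<⇒≤ t<i*))) (sym (vertexAt-a t<i*))
                                 (hop-up a (ℕP.<-≤-trans t<i* i*≤)))
        (no t≮i*)  → let i*≤t = ℕP.≮⇒≥ t≮i* in
                     inj₂ (subst₂ Hop (sym (vertexAt-b (ℕP.m≤n⇒m≤1+n i*≤t)))
                                 (sym (trans (vertexAt-b i*≤t) (cong (λ k → (par ^ k) b) (ℕP.+-∸-assoc 1 t<len))))
                                 (hop-up b (ℕP.<-≤-trans (b-index< (s≤s i*≤t) t<len) j*≤)))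

      hopEdge : ∀ {x y} → Hop x y ⊎ Hop y x → Fin m × Fin 2
      hopEdge {x}     (inj₁ (x∉U , _)) = tailOf G (stepAt treeTails x x∉U)
      hopEdge {y = y} (inj₂ (y∉U , _)) = Step.edge (stepAt treeTails y y∉U) , other (Step.side (stepAt treeTails y y∉U))

      hopEdge-ends : ∀ {x y} (h : Hop x y ⊎ Hop y x) →
                     end (proj₁ (hopEdge h)) (proj₂ (hopEdge h)) ≡ x × end (proj₁ (hopEdge h)) (other (proj₂ (hopEdge h))) ≡ y
      hopEdge-ends {x}     (inj₁ (x∉U , px≡y)) =
        Step.at (stepAt treeTails x x∉U) , trans (sym (parent-outside treeTails x∉U)) px≡y
      hopEdge-ends {y = y} (inj₂ (y∉U , py≡x)) =
        trans (sym (parent-outside treeTails y∉U)) py≡x ,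
        trans (cong (end _) (other-involutive _)) (Step.at (stepAt treeTails y y∉U))

      hopEdge-owned : ∀ {x y} (h : Hop x y ⊎ Hop y x) →
                      ∃[ z ] Σ (¬ InU z) λ z∉U → Step.edge (stepAt treeTails z z∉U) ≡ proj₁ (hopEdge h)
      hopEdge-owned {x}     (inj₁ (x∉U , _)) = x , x∉U , refl
      hopEdge-owned {y = y} (inj₂ (y∉U , _)) = y , y∉U , refl

      trailEdge : ℕ → Fin m × Fin 2
      trailEdge t with t <? len
      ... | yes t<len = hopEdge (hop t<len)
      ... | no _      = e , suc zero

      trailEdge-cases : ∀ {t} → t ≤ len →
        (Σ (t < len) λ t<len → trailEdge t ≡ hopEdge (hop t<len)) ⊎ (t ≡ len × trailEdge t ≡ (e , suc zero))
      trailEdge-cases {t} t≤len with t <? len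
      ... | yes t<len = inj₁ (t<len , refl)
      ... | no t≮len  = inj₂ (ℕP.≤-antisym t≤len (ℕP.≮⇒≥ t≮len) , refl)

      private
        edgeAt : ℕ → Fin m
        edgeAt = proj₁ ∘ trailEdge
        sideAt : ℕ → Fin 2
        sideAt = proj₂ ∘ trailEdge

        vertexAt-len : vertexAt len ≡ b
        vertexAt-len = trans (vertexAt-b (ℕP.m≤m+n i* j*)) (cong (λ k → (par ^ k) b) (ℕP.n∸n≡0 len))

        trail-∈ : ∀ t → t ≤ len → edgeAt t ∈ F
        trail-∈ t t≤len with trailEdge-cases t≤len
        ... | inj₁ (t<len , et) = subst (_∈ F) (cong proj₁ (sym et)) (case hopEdge-owned (hop t<len) of λ where
                                    (z , z∉U , owned) → subst (_∈ F) owned (treeTails-∈ z∉U))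
        ... | inj₂ (_ , et)     = subst (_∈ F) (cong proj₁ (sym et)) e∈F

        trail-leaves : ∀ t → t ≤ len → end (edgeAt t) (sideAt t) ≡ vertexAt t
        trail-leaves t t≤len with trailEdge-cases t≤len
        ... | inj₁ (t<len , et) = subst (λ (f , s) → end f s ≡ vertexAt t) (sym et) (proj₁ (hopEdge-ends (hop t<len)))
        ... | inj₂ (refl , et)  = subst (λ (f , s) → end f s ≡ vertexAt len) (sym et) (sym vertexAt-len)

        trail-enters : ∀ t → t < len → end (edgeAt t) (other (sideAt t)) ≡ vertexAt (suc t)
        trail-enters t t<len with trailEdge-cases (ℕP.<⇒≤ t<len)
        ... | inj₁ (t<len′ , et) = subst (λ (f , s) → end f (other s) ≡ vertexAt (suc t)) (sym et)
                                         (proj₂ (hopEdge-ends (hop t<len′)))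
        ... | inj₂ (refl , _)    = ⊥-elim (ℕP.<-irrefl refl t<len)

        trail-closes : end (edgeAt len) (other (sideAt len)) ≡ vertexAt 0
        trail-closes with trailEdge-cases (ℕP.≤-refl {len})
        ... | inj₁ (len<len , _) = ⊥-elim (ℕP.<-irrefl refl len<len)
        ... | inj₂ (_ , et)      = subst (λ (f , s) → end f (other s) ≡ vertexAt 0) (sym et) (sym (vertexAt-a z≤n))

        open-edge-owned : ∀ {t} → t < len → ∃[ z ] Σ (¬ InU z) λ z∉U → Step.edge (stepAt treeTails z z∉U) ≡ edgeAt t
        open-edge-owned {t} t<len with trailEdge-cases (ℕP.<⇒≤ t<len)
        ... | inj₁ (t<len′ , et) = subst (λ f → ∃[ z ] Σ (¬ InU z) λ z∉U → Step.edge (stepAt treeTails z z∉U) ≡ f)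
                                         (cong proj₁ (sym et)) (hopEdge-owned (hop t<len′))
        ... | inj₂ (refl , _)    = ⊥-elim (ℕP.<-irrefl refl t<len)

        closing-edge : edgeAt len ≡ e
        closing-edge with trailEdge-cases (ℕP.≤-refl {len})
        ... | inj₁ (len<len , _) = ⊥-elim (ℕP.<-irrefl refl len<len)
        ... | inj₂ (_ , et)      = cong proj₁ et

        open-edge-is-not-e : ∀ {t} → t < len → edgeAt t ≢ e
        open-edge-is-not-e t<len edge≡e with open-edge-owned t<len
        ... | z , z∉U , owned = unowned z∉U (trans owned edge≡e)

        trail-edge-injective : ∀ {t t′} → t ≤ len → t′ ≤ len → edgeAt t ≡ edgeAt t′ → t ≡ t′
        trail-edge-injective {t} {t′} t≤len t′≤len eq with ℕP.m≤n⇒m<n∨m≡n t≤len | ℕP.m≤n⇒m<n∨m≡n t′≤len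
        ... | inj₂ t≡len | inj₂ t′≡len = trans t≡len (sym t′≡len)
        ... | inj₁ t<len | inj₂ refl    = ⊥-elim (open-edge-is-not-e t<len (trans eq closing-edge))
        ... | inj₂ refl  | inj₁ t′<len  = ⊥-elim (open-edge-is-not-e t′<len (trans (sym eq) closing-edge))
        ... | inj₁ t<len | inj₁ t′<len with same-or-other (sideAt t) (sideAt t′)
        ...   | inj₁ same = vertexAt-injective t≤len t′≤len
                  (trans (sym (trail-leaves t t≤len)) (trans (cong₂ end eq same) (trail-leaves t′ t′≤len)))
        ...   | inj₂ opposite = ⊥-elim (ℕP.<⇒≢ (ℕP.m<n⇒m<1+n (ℕP.n<1+n t′)) (trans t′≡1+t (cong suc t≡1+t′)))
          where
          t≡1+t′ : t ≡ suc t′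
          t≡1+t′ = vertexAt-injective t≤len t′<len
            (trans (sym (trail-leaves t t≤len)) (trans (cong₂ end eq opposite) (trail-enters t′ t′<len)))
          t′≡1+t : t′ ≡ suc t
          t′≡1+t = sym (vertexAt-injective t<len t′≤len (trans (sym (trail-enters t t<len))
            (trans (cong₂ end eq (trans (cong other opposite) (other-involutive _))) (trail-leaves t′ t′≤len))))

      trail : ClosedTrail G {F}
      trail = record
        { len              = len
        ; edgeAt           = edgeAt
        ; sideAt           = sideAt
        ; vertexAt         = vertexAt
        ; inF              = trail-∈
        ; leaves           = trail-leaves
        ; enters           = trail-enters
        ; closes           = trail-closes
        ; edge-injective   = trail-edge-injective
        ; vertex-injective = vertexAt-injective
        }

    abstract
      F⊆tailForest : F ⊆ T.tailForest
      F⊆tailForest {e} e∈F with T.owned? e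
      ... | yes owned = ∈-subset⁺ T.owned? owned
      ... | no ¬owned = ⊥-elim (acyclic (closedTrail⇒cycle G (UnownedEdge.trail e∈F (λ x∉U owns → ¬owned (_ , x∉U , owns)))))

  module TailsOfTailForest (c : Assign) (rooted : Rooted c) where
    open TailForest c
    open RootedParent c rooted
    open Walks tailForest

    height-bounds-walks : ∀ k y → ReachesU k y → height y ≤ k
    height-bounds-walks zero    y y∈U = ℕP.≤-reflexive (height-absorbed y∈U)
    height-bounds-walks (suc k) _ (e , s , e∈ , refl , r) with owned-from-an-end e∈ s
    ... | inj₁ o = ℕP.≤-trans (ℕP.≤-reflexive (owner-taller rooted o)) (s≤s (height-bounds-walks k _ r))
    ... | inj₂ o = ℕP.m≤n⇒m≤1+n (ℕP.≤-trans (ℕP.<⇒≤ below) (height-bounds-walks k _ r))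
      where
      below : height (end e s) < height (end e (other s))
      below = ℕP.≤-reflexive (sym (trans (owner-taller rooted o) (cong (suc ∘ height ∘ end e) (other-involutive s))))

    walk-of-height : ∀ k v → height v ≡ k → ReachesU k v
    walk-of-height zero    v eq = subst (λ k → InU ((parent c ^ k) v)) eq (height-reaches v)
    walk-of-height (suc k) v eq = case inU? v of λ where
      (yes v∈U) → ⊥-elim (ℕP.0≢1+n (trans (sym (height-absorbed v∈U)) eq))
      (no v∉U)  → Step.edge (stepAt c v v∉U) , Step.side (stepAt c v v∉U) , tail-∈ v∉U , Step.at (stepAt c v v∉U) ,
                  subst (ReachesU k) (parent-outside c v∉U)
                        (walk-of-height k (parent c v) (ℕP.suc-injective (trans (sym (height-step v∉U)) eq)))

    private
      tail-recovered : ∀ {v} (v∉U : ¬ InU v) {k} (d : DownStep k v) → k < height v →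
                       tailOf G (stepAt c v v∉U) ≡ (proj₁ d , proj₁ (proj₂ d))
      tail-recovered v∉U (e , s , e∈ , refl , r) k<h with owned-from-an-end e∈ s
      ... | inj₁ (_ , tail≡) = tail≡
      ... | inj₂ o = ⊥-elim (ℕP.<-asym k<h (ℕP.<-≤-trans (ℕP.≤-reflexive (sym taller)) (height-bounds-walks _ _ r)))
        where
        taller : height (end e (other s)) ≡ suc (height (end e s))
        taller = trans (owner-taller rooted o) (cong (suc ∘ height ∘ end e) (other-involutive s))

    tails-recovered : ∀ tutte → TailEq c (TreeTails.treeTails tailForest tutte)
    tails-recovered tutte v p q =
      tail-recovered v∉U (downStep v p q) (subst (ℕ.pred (distance v) <_) (sym (height-step v∉U))
        (s≤s (ℕP.pred-mono-≤ (subst (distance v ≤_) (height-step v∉U) (distance-minimal v _ (walk-of-height _ v refl))))))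
      where
      open TreeTails tailForest tutte using (downStep; distance; distance-minimal)
      v∉U : ¬ InU v
      v∉U = [ p , q ]′

  treeTails-tutte-irrelevant : ∀ F t t′ → TailEq (TreeTails.treeTails F t) (TreeTails.treeTails F t′)
  treeTails-tutte-irrelevant F t t′ v p q =
    Walks.canonical-firstTail F (ℕP.≤-antisym (A.distance-minimal v _ (B.distance-reaches v))
                                              (B.distance-minimal v _ (A.distance-reaches v))) _ _ p q
    where
    module A = TreeTails F t
    module B = TreeTails F t′

  AssignEq-sym : ∀ {c d} → AssignEq G u₁ u₂ w₁ w₂ c d → AssignEq G u₁ u₂ w₁ w₂ d c
  AssignEq-sym c≈d v p q = let (k , e , s) = c≈d v p q in sym k , sym e , sym s

  Tutte2Arb : Set
  Tutte2Arb = Σ (Subset m) (IsTutte2Arborescence G u₁ u₂ w₁ w₂)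

  contributorOf : Tutte2Arb → Ĉ¹ G u₁ u₂ w₁ w₂
  contributorOf (F , tutte) = canonical T , C.canonical-contributor , C.canonical-single-class
    where
    T : Assign
    T = TreeTails.treeTails F tutte
    module C = Canonical T (TreeTails.treeTails-rooted F tutte) (TreeTails.treeTails-roots-differ F tutte)

  SameContributor : Tutte2Arb → Tutte2Arb → Set
  SameContributor x y = AssignEq G u₁ u₂ w₁ w₂ (proj₁ (contributorOf x)) (proj₁ (contributorOf y))

  contributorOf-cong : ∀ {x y : Tutte2Arb} → proj₁ x ≡ proj₁ y → SameContributor x y
  contributorOf-cong {F , t} {.F , t′} refl =
    proj₂ (proj₂ (contributorOf (F , t))) _ (proj₁ (proj₂ (contributorOf (F , t′)))) (treeTails-tutte-irrelevant F t t′)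

  private
    contributorOf-⊆ : ∀ {x y : Tutte2Arb} → SameContributor x y → proj₁ x ⊆ proj₁ y
    contributorOf-⊆ {F , t} {F′ , t′} c≈c′ e∈F =
      let (x , x∉U , owns) = TailForest.tailForest-owned (TreeTails.treeTails F t) (TreeTails.F⊆tailForest F t e∈F)
          same-edge = proj₁ (proj₂ (c≈c′ x (x∉U ∘ inj₁) (x∉U ∘ inj₂)))
      in subst (_∈ F′) (trans (sym same-edge) owns) (TreeTails.treeTails-∈ F′ t′ x∉U)

  contributorOf-injective : ∀ {x y : Tutte2Arb} → SameContributor x y → proj₁ x ≡ proj₁ y
  contributorOf-injective {x} {y} c≈c′ =
    ⊆-antisym (contributorOf-⊆ {x} {y} c≈c′)
              (contributorOf-⊆ {y} {x} (AssignEq-sym {proj₁ (contributorOf x)} {proj₁ (contributorOf y)} c≈c′))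

  private
    contributorOf-recovers : ∀ c → SingleClass G u₁ u₂ w₁ w₂ c → (rooted : Rooted c) →
                             ∀ {z : Tutte2Arb} → proj₁ z ≡ TailForest.tailForest c →
                             AssignEq G u₁ u₂ w₁ w₂ (proj₁ (contributorOf z)) c
    contributorOf-recovers c single rooted {F , t} refl =
      AssignEq-sym {c} {proj₁ (contributorOf (F , t))}
        (single (proj₁ (contributorOf (F , t))) (proj₁ (proj₂ (contributorOf (F , t))))
                (TailsOfTailForest.tails-recovered c rooted t))

    tailForestOf : Ĉ¹ G u₁ u₂ w₁ w₂ → Tutte2Arb
    tailForestOf (c , c-bij , single) =
      TailForest.tailForest c , TailForest.tailForest-tutte c rooted (RootedContributor.roots-differ c c-bij rooted)
      where
      rooted : Rooted c
      rooted = single-class⇒rooted c c-bij single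

  contributorOf-surjective : ∀ (c : Ĉ¹ G u₁ u₂ w₁ w₂) →
    Σ[ x ∈ Tutte2Arb ] (∀ {z : Tutte2Arb} → proj₁ z ≡ proj₁ x → AssignEq G u₁ u₂ w₁ w₂ (proj₁ (contributorOf z)) (proj₁ c))
  -- {z} is passed on explicitly for the same reason as in lemma2p3 below.
  contributorOf-surjective c@(c₀ , c-bij , single) =
    tailForestOf c , λ {z} → contributorOf-recovers c₀ single (single-class⇒rooted c₀ c-bij single) {z}

lemma2p3 : (G : BidirectedGraph) (u₁ u₂ w₁ w₂ : Vertex G) →
    u₁ ≢ u₂ → w₁ ≢ w₂ →
    Bijection (Tutte2Arb-setoid G u₁ u₂ w₁ w₂) (Ĉ¹-setoid G u₁ u₂ w₁ w₂)
-- The implicit arguments are passed on explicitly: proj₁ does not determine them, and solving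
-- for them would unfold contributorOf.
lemma2p3 G u₁ u₂ w₁ w₂ u₁≢u₂ w₁≢w₂ = record
  { to        = contributorOf
  ; cong      = λ {x} {y} → contributorOf-cong {x} {y}
  ; bijective = (λ {x} {y} → contributorOf-injective {x} {y}) , contributorOf-surjective
  }
  where open Correspondence G u₁ u₂ w₁ w₂ u₁≢u₂ w₁≢w₂
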